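{- We have $W_{N}^{\ast}(\widehat{\mathcal{X}}_{p}(N))=-\widehat{\mathcal{X}}_{p}(N)$. Let $n=\nu_{p}(N)\geq0$; then \begin{equation*} \langle\widehat{\mathcal{X}}_{p}(N),\widehat{\mathcal{X}}_{p}(N)\rangle=\frac{\psi(N)}{24}\cdot\frac{ -np^{n+1}+2p^{n}+np^{n-1}-2}{p^{n-1}(p^{2}-1)}\cdot\log(p). \end{equation*}
   Context: $\mathcal{X}_0(N)$ is the regular proper flat Deligne–Mumford stack over $\mathbb{Z}$ compactifying the Katz–Mazur moduli stack of cyclic $N$-isogenies $E\to E'$; $W_N$ is the Atkin–Lehner involution $(E\xrightarrow{\pi}E')\mapsto(E'\xrightarrow{\pi^\vee}E)$, $\psi(N)=N\prod_{\ell|N}(1+\ell^{ -1})$, $\varphi$ Euler's function. $p$ is a prime, $n=\nu_p(N)$, $N_p=p^{ -n}N$. For $-n\le a\le n$, $a\equiv n\bmod 2$, $\mathcal{X}_p^a(N)$ are the irreducible components of $\mathcal{X}_0(N)_{\mathbb{F}_p}$ (Katz–Mazur), with $W_N(\mathcal{X}_p^a(N))=\mathcal{X}_p^{ -a}(N)$, $\textup{div}(p)=\sum_a\varphi(p^{(n-|a|)/2})\mathcal{X}_p^a(N)$, and $\widehat{\mathcal{X}}_p^a(N)=(\mathcal{X}_p^a(N),0)\in\widehat{\textup{CH}}^1(\mathcal{X}_0(N))$. $\langle\cdot,\cdot\rangle$ is the arithmetic intersection pairing on $\widehat{\textup{CH}}^1(\mathcal{X}_0(N))$; one has $\langle\widehat{\mathcal{X}}^a_p(N),\widehat{\mathcal{X}}^b_p(N)\rangle=\log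 p\cdot\frac{\psi(N_p)(p-1)}{24}p^{\min\{|a|,|b|\}}$ if $a\ne b$, $ab\ge0$; $=\log p\cdot\frac{\psi(N_p)(p-1)}{24}$ if $ab\le0$, $a\neq b$; and self-intersection $-\log p\cdot\frac{\psi(N_p)p^{|a|}}{12}$ if $|a|\ne n$, $-\log p\cdot\frac{\psi(N_p)(p-1)p^{n-1}}{24}$ if $|a|=n$. Define $\widehat{\mathcal{X}}_{p}(N)=\frac{n}{2}\widehat{\mathcal{X}}^{n}_{p}(N)-\frac{n}{2}\widehat{\mathcal{X}}^{ -n}_{p}(N)+\sum_{ -n<a<n,\ a\equiv n\bmod 2}\frac{a}{2}\, p^{(n-|a|)/2-1}(p-1)\widehat{\mathcal{X}}^{a}_{p}(N)$. -}

module Defs where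

open import Level using (0ℓ)
open import Data.Nat as ℕ using (ℕ; zero; suc)
import Data.Nat.DivMod as ℕD
open import Data.Nat.Divisibility using (_∣_; _∣?_)
open import Data.Nat.Primality using (Prime; prime?)
open import Data.Integer as ℤ using (ℤ; +_)
open import Data.Rational as ℚ using (ℚ; 0ℚ; 1ℚ)
open import Data.Rational.Properties using (+-*-commutativeRing)
open import Data.List using (List; []; _∷_; map; upTo; foldr; filter)
open import Data.Product using (_×_)
open import Relation.Nullary using (yes; no; ¬_)
open import Relation.Nullary.Decidable using (_×-dec_)
open import Algebra.Module.Bundles using (Module)
open import Relation.Binary.PropositionalEquality using (_≡_)

ℚ-ring = +-*-commutativeRing

ℕ→ℚ : ℕ → ℚ
ℕ→ℚ m = (+ m) ℚ./ 1

ℤ→ℚ : ℤ → ℚ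
ℤ→ℚ z = z ℚ./ 1

-- total division on ℚ (x ⊘ 0 = 0); only ever used with nonzero divisors here
_⊘_ : ℚ → ℚ → ℚ
x ⊘ y with y ℚ.≟ 0ℚ
... | yes _ = 0ℚ
... | no y≢0 = ℚ._÷_ x y {{ℚ.≢-nonZero y≢0}}

infixl 7 _⊘_

_^ℚ_ : ℚ → ℕ → ℚ
x ^ℚ zero = 1ℚ
x ^ℚ suc k = x ℚ.* (x ^ℚ k)

primeDivisors : ℕ → List ℕ
primeDivisors N = filter (λ ℓ → prime? ℓ ×-dec (ℓ ∣? N)) (map suc (upTo N))

ψ : ℕ → ℚ
ψ N = ℕ→ℚ N ℚ.* foldr (λ ℓ acc → (1ℚ ℚ.+ (1ℚ ⊘ ℕ→ℚ ℓ)) ℚ.* acc) 1ℚ (primeDivisors N)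

Valid : ℕ → ℤ → Set
Valid n a = (ℤ.- (+ n) ℤ.≤ a) × (a ℤ.≤ + n) × (2 ∣ ℤ.∣ a ℤ.- + n ∣)

module _ (V : Module ℚ-ring 0ℓ 0ℓ) where
  open Module V

  sumᴹ : List Carrierᴹ → Carrierᴹ
  sumᴹ = foldr _+ᴹ_ 0ᴹ

  innerIndices : ℕ → List ℤ
  innerIndices n = map (λ k → + n ℤ.- + (2 ℕ.* suc k)) (upTo (n ℕ.∸ 1))

  innerCoeff : (p n : ℕ) → ℤ → ℚ
  innerCoeff p n a = (a ℚ./ 2) ℚ.* ℕ→ℚ (p ℕ.^ ((n ℕ.∸ ℤ.∣ a ∣) ℕD./ 2 ℕ.∸ 1) ℕ.* (p ℕ.∸ 1))

  Xhat : (p n : ℕ) → (ℤ → Carrierᴹ) → Carrierᴹ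
  Xhat p n X =
    ((+ n ℚ./ 2) *ₗ X (+ n)) +ᴹ ((ℚ.- (+ n ℚ./ 2)) *ₗ X (ℤ.- (+ n)))
      +ᴹ sumᴹ (map (λ a → innerCoeff p n a *ₗ X a) (innerIndices n))

-- Abstract data: an (ℚ-linearised) arithmetic Chow group V, the target R of the
-- pairing (a ℚ-module standing for ℝ) with L standing for log p, the components
-- X a = X̂^a_p(N), W = W_N^*, pair = ⟨·,·⟩, with the properties from the context.
record Hyp (p n Np : ℕ) (V R : Module ℚ-ring 0ℓ 0ℓ) (L : Module.Carrierᴹ R)
           (X : ℤ → Module.Carrierᴹ V) (W : Module.Carrierᴹ V → Module.Carrierᴹ V)
           (pair : Module.Carrierᴹ V → Module.Carrierᴹ V → Module.Carrierᴹ R) : Set where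
  private
    module V = Module V
    module R = Module R
    c : ℚ
    c = ψ Np ℚ.* ℕ→ℚ (p ℕ.∸ 1) ℚ.* (1ℚ ⊘ ℕ→ℚ 24)
    P : ℕ → ℚ
    P k = ℕ→ℚ (p ℕ.^ k)
  field
    W-cong : ∀ {x y} → x V.≈ᴹ y → W x V.≈ᴹ W y
    W-+    : ∀ x y → W (x V.+ᴹ y) V.≈ᴹ (W x V.+ᴹ W y)
    W-*    : ∀ (q : ℚ) x → W (q V.*ₗ x) V.≈ᴹ (q V.*ₗ W x)
    W-X    : ∀ a → Valid n a → W (X a) V.≈ᴹ X (ℤ.- a)
    pair-cong : ∀ {x x′ y y′} → x V.≈ᴹ x′ → y V.≈ᴹ y′ → pair x y R.≈ᴹ pair x′ y′
    pair-+ˡ : ∀ x x′ y → pair (x V.+ᴹ x′) y R.≈ᴹ (pair x y R.+ᴹ pair x′ y)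
    pair-+ʳ : ∀ x y y′ → pair x (y V.+ᴹ y′) R.≈ᴹ (pair x y R.+ᴹ pair x y′)
    pair-*ˡ : ∀ (q : ℚ) x y → pair (q V.*ₗ x) y R.≈ᴹ (q R.*ₗ pair x y)
    pair-*ʳ : ∀ (q : ℚ) x y → pair x (q V.*ₗ y) R.≈ᴹ (q R.*ₗ pair x y)
    pair-same-sign : ∀ a b → Valid n a → Valid n b → ¬ (a ≡ b) → ℤ.0ℤ ℤ.≤ a ℤ.* b →
      pair (X a) (X b) R.≈ᴹ ((c ℚ.* P (ℕ._⊓_ ℤ.∣ a ∣ ℤ.∣ b ∣)) R.*ₗ L)
    pair-opp-sign : ∀ a b → Valid n a → Valid n b → ¬ (a ≡ b) → a ℤ.* b ℤ.≤ ℤ.0ℤ →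
      pair (X a) (X b) R.≈ᴹ (c R.*ₗ L)
    pair-self-inner : ∀ a → Valid n a → ¬ (ℤ.∣ a ∣ ≡ n) →
      pair (X a) (X a) R.≈ᴹ ((ℚ.- (ψ Np ℚ.* P ℤ.∣ a ∣ ℚ.* (1ℚ ⊘ ℕ→ℚ 12))) R.*ₗ L)
    pair-self-outer : ∀ a → Valid n a → ℤ.∣ a ∣ ≡ n → 1 ℕ.≤ n →
      pair (X a) (X a) R.≈ᴹ ((ℚ.- (ψ Np ℚ.* ℕ→ℚ (p ℕ.∸ 1) ℚ.* P (n ℕ.∸ 1) ℚ.* (1ℚ ⊘ ℕ→ℚ 24))) R.*ₗ L)

selfConst : (p n N : ℕ) → ℚ
selfConst p n N =
  (ψ N ⊘ ℕ→ℚ 24) ℚ.*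
    ((ℚ.- (ℕ→ℚ n ℚ.* (pq ^ℚ (n ℕ.+ 1))) ℚ.+ ℕ→ℚ 2 ℚ.* (pq ^ℚ n)
       ℚ.+ ℕ→ℚ n ℚ.* pnm1 ℚ.- ℕ→ℚ 2)
     ⊘ (pnm1 ℚ.* ((pq ^ℚ 2) ℚ.- 1ℚ)))
  where
    pq = ℕ→ℚ p
    -- p^{n-1} as a rational number (equals 1/p when n = 0)
    pnm1 = (pq ^ℚ n) ⊘ pq

-- X̂_p(N) = Σ_a c_a X̂^a with c_a = (a/2)·φ(p^((n-|a|)/2)), a coefficient that is odd in a.
-- Since W_N^* maps X̂^a to X̂^(-a), W_N^*(X̂_p(N)) + X̂_p(N) = Σ_a c_a (X̂^a + X̂^(-a)) = 0.
--
-- For the self-intersection let S_n be the part of X̂_p(N) with |a| < n. Then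
-- S_(n+2) = p·S_n + (n/2)(p-1)(X̂^n - X̂^(-n)), and ⟨X̂^a, X̂^b⟩ does not depend on n unless
-- a = b = ±n. Induction on n in steps of two therefore gives closed forms for ⟨X̂^c, S_n⟩
-- (|c| ≥ n) and for ⟨S_n, S_n⟩. Adding the terms of X̂^(±n) yields
-- ⟨X̂_p(N), X̂_p(N)⟩ = ψ(N_p)/24 · (2(1 + p + ⋯ + p^(n-1)) - n(p+1)p^(n-1)) · log p,
-- the stated value since ψ(N) = p^(n-1)(p+1)ψ(N_p).

module Submission where

open import Defs
open import Level using (0ℓ)
open import Data.Nat using (ℕ; zero; suc; _≤_)
open import Data.Nat.Divisibility using (_∣_)
open import Data.Nat.Primality using (Prime)
open import Data.Integer using (ℤ)
open import Data.Product using (_×_; _,_)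
open import Relation.Nullary using (¬_)
open import Algebra.Module.Bundles using (Module)

module RationalArithmetic where
  open import Data.Maybe.Base using (Maybe; just; nothing)
  import Data.Nat as ℕ
  open import Data.Integer as ℤ using (+_)
  import Data.Integer.Properties as ℤP
  import Data.Integer.Tactic.RingSolver as ℤ-Solver
  open import Data.Rational as ℚ using (ℚ; 0ℚ; 1ℚ; ½; _+_; _*_; _-_)
  import Data.Rational.Properties as ℚP
  open import Data.Rational.Unnormalised as ℚᵘ using (mkℚᵘ; *≡*)
  import Data.Rational.Unnormalised.Properties as ℚᵘP
  open import Relation.Binary.PropositionalEquality
  open import Relation.Nullary using (yes; no)
  open import Data.Empty using (⊥-elim)
  import Tactic.RingSolver.Core.AlmostCommutativeRing as ACR
  open import Tactic.RingSolver using (solve-∀) public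

  ℚ-ring-for-solver : ACR.AlmostCommutativeRing 0ℓ 0ℓ
  ℚ-ring-for-solver = ACR.fromCommutativeRing ℚP.+-*-commutativeRing isZero
    where
    isZero : ∀ x → Maybe (0ℚ ≡ x)
    isZero x with 0ℚ ℚP.≟ x
    ... | yes 0≡x = just 0≡x
    ... | no _ = nothing

  toℚᵘ-ℤ→ℚ : ∀ i → ℚ.toℚᵘ (ℤ→ℚ i) ℚᵘ.≃ mkℚᵘ i 0
  toℚᵘ-ℤ→ℚ i = ℚP.toℚᵘ-fromℚᵘ (mkℚᵘ i 0)

  ℤ→ℚ-+ : ∀ i j → ℤ→ℚ (i ℤ.+ j) ≡ ℤ→ℚ i + ℤ→ℚ j
  ℤ→ℚ-+ i j = ℚP.toℚᵘ-injective (begin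
      ℚ.toℚᵘ (ℤ→ℚ (i ℤ.+ j))                       ≈⟨ toℚᵘ-ℤ→ℚ (i ℤ.+ j) ⟩
      mkℚᵘ (i ℤ.+ j) 0                             ≈⟨ *≡* (cross-multiplied i j) ⟩
      mkℚᵘ i 0 ℚᵘ.+ mkℚᵘ j 0                       ≈⟨ ℚᵘP.+-cong (ℚᵘP.≃-sym (toℚᵘ-ℤ→ℚ i)) (ℚᵘP.≃-sym (toℚᵘ-ℤ→ℚ j)) ⟩
      ℚ.toℚᵘ (ℤ→ℚ i) ℚᵘ.+ ℚ.toℚᵘ (ℤ→ℚ j)          ≈⟨ ℚP.toℚᵘ-homo-+ (ℤ→ℚ i) (ℤ→ℚ j) ⟨
      ℚ.toℚᵘ (ℤ→ℚ i + ℤ→ℚ j)                      ∎)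
    where
    open ℚᵘP.≃-Reasoning
    cross-multiplied : ∀ i j → (i ℤ.+ j) ℤ.* ℤ.1ℤ ≡ (i ℤ.* ℤ.1ℤ ℤ.+ j ℤ.* ℤ.1ℤ) ℤ.* ℤ.1ℤ
    cross-multiplied = ℤ-Solver.solve-∀

  ℤ→ℚ-* : ∀ i j → ℤ→ℚ (i ℤ.* j) ≡ ℤ→ℚ i * ℤ→ℚ j
  ℤ→ℚ-* i j = ℚP.toℚᵘ-injective (begin
      ℚ.toℚᵘ (ℤ→ℚ (i ℤ.* j))                       ≈⟨ toℚᵘ-ℤ→ℚ (i ℤ.* j) ⟩
      mkℚᵘ i 0 ℚᵘ.* mkℚᵘ j 0                       ≈⟨ ℚᵘP.*-cong (ℚᵘP.≃-sym (toℚᵘ-ℤ→ℚ i)) (ℚᵘP.≃-sym (toℚᵘ-ℤ→ℚ j)) ⟩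
      ℚ.toℚᵘ (ℤ→ℚ i) ℚᵘ.* ℚ.toℚᵘ (ℤ→ℚ j)          ≈⟨ ℚP.toℚᵘ-homo-* (ℤ→ℚ i) (ℤ→ℚ j) ⟨
      ℚ.toℚᵘ (ℤ→ℚ i * ℤ→ℚ j)                      ∎)
    where open ℚᵘP.≃-Reasoning

  /2≡*½ : ∀ i → i ℚ./ 2 ≡ ℤ→ℚ i * ½
  /2≡*½ i = ℚP.toℚᵘ-injective (begin
      ℚ.toℚᵘ (i ℚ./ 2)                             ≈⟨ ℚP.toℚᵘ-fromℚᵘ (mkℚᵘ i 1) ⟩
      mkℚᵘ i 1                                     ≈⟨ *≡* (cong (ℤ._* + 2) (sym (ℤP.*-identityʳ i))) ⟩
      mkℚᵘ i 0 ℚᵘ.* ℚ.toℚᵘ ½                       ≈⟨ ℚᵘP.*-congʳ (ℚᵘP.≃-sym (toℚᵘ-ℤ→ℚ i)) ⟩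
      ℚ.toℚᵘ (ℤ→ℚ i) ℚᵘ.* ℚ.toℚᵘ ½                ≈⟨ ℚP.toℚᵘ-homo-* (ℤ→ℚ i) ½ ⟨
      ℚ.toℚᵘ (ℤ→ℚ i * ½)                          ∎)
    where open ℚᵘP.≃-Reasoning

  ℕ→ℚ-+ : ∀ a b → ℕ→ℚ (a ℕ.+ b) ≡ ℕ→ℚ a + ℕ→ℚ b
  ℕ→ℚ-+ a b = ℤ→ℚ-+ (+ a) (+ b)

  ℕ→ℚ-* : ∀ a b → ℕ→ℚ (a ℕ.* b) ≡ ℕ→ℚ a * ℕ→ℚ b
  ℕ→ℚ-* a b = trans (cong ℤ→ℚ (ℤP.pos-* a b)) (ℤ→ℚ-* (+ a) (+ b))

  ℕ→ℚ-^ : ∀ a k → ℕ→ℚ (a ℕ.^ k) ≡ ℕ→ℚ a ^ℚ k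
  ℕ→ℚ-^ a zero = refl
  ℕ→ℚ-^ a (suc k) = trans (ℕ→ℚ-* a (a ℕ.^ k)) (cong (ℕ→ℚ a *_) (ℕ→ℚ-^ a k))

  ℕ→ℚ-pred : ∀ {a} → 1 ≤ a → ℕ→ℚ (a ℕ.∸ 1) ≡ ℕ→ℚ a - 1ℚ
  ℕ→ℚ-pred {suc a} _ = trans (shift (ℕ→ℚ a)) (cong (_- 1ℚ) (sym (ℕ→ℚ-+ 1 a)))
    where
    shift : ∀ x → x ≡ (1ℚ + x) - 1ℚ
    shift = solve-∀ ℚ-ring-for-solver

  ℕ→ℚ-≢0 : ∀ {a} → a ≢ 0 → ℕ→ℚ a ≢ 0ℚ
  ℕ→ℚ-≢0 {zero} 0≢0 = ⊥-elim (0≢0 refl)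
  ℕ→ℚ-≢0 {suc a} _ eq with subst ℚ.Positive eq (ℚP.normalize-pos (suc a) 1)
  ... | ()

  ⊘-≡-*-1⊘ : ∀ x y → x ⊘ y ≡ x * (1ℚ ⊘ y)
  ⊘-≡-*-1⊘ x y with y ℚ.≟ 0ℚ
  ... | yes _ = sym (ℚP.*-zeroʳ x)
  ... | no _ = cong (x *_) (sym (ℚP.*-identityˡ _))

  *-⊘-cancel : ∀ x {y} → y ≢ 0ℚ → (x * y) ⊘ y ≡ x
  *-⊘-cancel x {y} y≢0 with y ℚ.≟ 0ℚ
  ... | yes y≡0 = ⊥-elim (y≢0 y≡0)
  ... | no y≢0′ = begin
      (x * y) * ℚ.1/ y   ≡⟨ ℚP.*-assoc x y (ℚ.1/ y) ⟩
      x * (y * ℚ.1/ y)   ≡⟨ cong (x *_) (ℚP.*-inverseʳ y) ⟩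
      x * 1ℚ             ≡⟨ ℚP.*-identityʳ x ⟩
      x                  ∎
    where
    open ≡-Reasoning
    instance _ = ℚ.≢-nonZero y≢0′

  *-≢0 : ∀ {x y} → x ≢ 0ℚ → y ≢ 0ℚ → x * y ≢ 0ℚ
  *-≢0 {x} {y} x≢0 y≢0 xy≡0 = x≢0 (begin
      x              ≡⟨ *-⊘-cancel x y≢0 ⟨
      (x * y) ⊘ y    ≡⟨ cong (_⊘ y) xy≡0 ⟩
      0ℚ ⊘ y         ≡⟨ ⊘-≡-*-1⊘ 0ℚ y ⟩
      0ℚ * (1ℚ ⊘ y)  ≡⟨ ℚP.*-zeroˡ (1ℚ ⊘ y) ⟩
      0ℚ             ∎)
    where open ≡-Reasoning

  *-⊘-assoc : ∀ x y z → x * (y ⊘ z) ≡ (x * y) ⊘ z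
  *-⊘-assoc x y z = begin
      x * (y ⊘ z)          ≡⟨ cong (x *_) (⊘-≡-*-1⊘ y z) ⟩
      x * (y * (1ℚ ⊘ z))   ≡⟨ ℚP.*-assoc x y _ ⟨
      x * y * (1ℚ ⊘ z)     ≡⟨ ⊘-≡-*-1⊘ (x * y) z ⟨
      (x * y) ⊘ z          ∎
    where open ≡-Reasoning

module DedekindPsi where
  open import Data.Nat as ℕ using (_<_; s≤s)
  import Data.Nat.Properties as ℕP
  open import Data.Nat.Divisibility using (_∣?_; _∣0; ∣-trans; n∣m*n; m∣m*n; ∣⇒≤; ∣1⇒≡1)
  open import Data.Nat.Primality using (prime?; euclidsLemma; prime⇒irreducible; ¬prime[1]; prime⇒nonZero)
  open import Data.Rational as ℚ using (ℚ; 1ℚ; _+_; _*_)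
  import Data.Rational.Properties as ℚP
  open import Data.List using (List; []; _∷_; _++_; foldr; filter; map; upTo; applyUpTo; [_])
  import Data.List.Properties as ListP
  open import Data.Sum using (inj₁; inj₂)
  open import Relation.Binary.PropositionalEquality hiding ([_])
  open import Relation.Nullary using (yes; no)
  open import Relation.Nullary.Decidable using (_×-dec_)
  open import Data.Empty using (⊥-elim)
  open import Function using (_∘_)
  open RationalArithmetic

  eulerFactor : ℕ → ℚ
  eulerFactor ℓ = 1ℚ + (1ℚ ⊘ ℕ→ℚ ℓ)

  ∏ : (ℕ → ℚ) → List ℕ → ℚ
  ∏ f = foldr (λ ℓ acc → f ℓ * acc) 1ℚ

  ∏-++ : ∀ f xs ys → ∏ f (xs ++ ys) ≡ ∏ f xs * ∏ f ys
  ∏-++ f [] ys = sym (ℚP.*-identityˡ _)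
  ∏-++ f (x ∷ xs) ys = trans (cong (f x *_) (∏-++ f xs ys)) (sym (ℚP.*-assoc (f x) _ _))

  ∏-* : ∀ f g xs → ∏ (λ ℓ → f ℓ * g ℓ) xs ≡ ∏ f xs * ∏ g xs
  ∏-* f g [] = refl
  ∏-* f g (x ∷ xs) = trans (cong (f x * g x *_) (∏-* f g xs)) (interchange (f x) (g x) _ _)
    where
    interchange : ∀ a b c d → a * b * (c * d) ≡ a * c * (b * d)
    interchange = solve-∀ ℚ-ring-for-solver

  ∏-cong : ∀ {f g} xs → (∀ ℓ → f ℓ ≡ g ℓ) → ∏ f xs ≡ ∏ g xs
  ∏-cong [] f≗g = refl
  ∏-cong (x ∷ xs) f≗g = cong₂ _*_ (f≗g x) (∏-cong xs f≗g)

  ψ-factor : ℕ → ℕ → ℚ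
  ψ-factor N ℓ with prime? ℓ ×-dec (ℓ ∣? N)
  ... | yes _ = eulerFactor ℓ
  ... | no _ = 1ℚ

  ∏-filter : ∀ N xs → ∏ eulerFactor (filter (λ ℓ → prime? ℓ ×-dec (ℓ ∣? N)) xs) ≡ ∏ (ψ-factor N) xs
  ∏-filter N [] = refl
  ∏-filter N (x ∷ xs) with prime? x | x ∣? N
  ... | yes _ | yes _ = cong (eulerFactor x *_) (∏-filter N xs)
  ... | yes _ | no _ = trans (∏-filter N xs) (sym (ℚP.*-identityˡ _))
  ... | no _ | _ = trans (∏-filter N xs) (sym (ℚP.*-identityˡ _))

  ∏[1…_] : ℕ → (ℕ → ℚ) → ℚ
  ∏[1… K ] f = ∏ f (applyUpTo suc K)

  ∏[1…]-suc : ∀ K f → ∏[1… suc K ] f ≡ ∏[1… K ] f * f (suc K)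
  ∏[1…]-suc K f = begin
      ∏ f (applyUpTo suc (suc K))          ≡⟨ cong (∏ f) (ListP.applyUpTo-∷ʳ suc K) ⟨
      ∏ f (applyUpTo suc K ++ [ suc K ])  ≡⟨ ∏-++ f (applyUpTo suc K) [ suc K ] ⟩
      ∏[1… K ] f * (f (suc K) * 1ℚ)       ≡⟨ cong (∏[1… K ] f *_) (ℚP.*-identityʳ _) ⟩
      ∏[1… K ] f * f (suc K)              ∎
    where open ≡-Reasoning

  ∏[1…]-stable : ∀ M d f → (∀ ℓ → M < ℓ → f ℓ ≡ 1ℚ) → ∏[1… d ℕ.+ M ] f ≡ ∏[1… M ] f
  ∏[1…]-stable M zero f trivial = refl
  ∏[1…]-stable M (suc d) f trivial = begin
      ∏[1… suc (d ℕ.+ M) ] f               ≡⟨ ∏[1…]-suc (d ℕ.+ M) f ⟩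
      ∏[1… d ℕ.+ M ] f * f (suc (d ℕ.+ M)) ≡⟨ cong₂ _*_ below top ⟩
      ∏[1… M ] f * 1ℚ                      ≡⟨ ℚP.*-identityʳ _ ⟩
      ∏[1… M ] f                           ∎
    where
    open ≡-Reasoning
    below = ∏[1…]-stable M d f trivial
    top = trivial (suc (d ℕ.+ M)) (s≤s (ℕP.m≤n+m M d))

  ψ≡*∏[1…] : ∀ N → ψ N ≡ ℕ→ℚ N * ∏[1… N ] (ψ-factor N)
  ψ≡*∏[1…] N = cong (ℕ→ℚ N *_) (trans (∏-filter N (map suc (upTo N))) (cong (∏ (ψ-factor N)) (ListP.map-upTo suc N)))

  factorAt : ℕ → ℕ → ℚ
  factorAt q ℓ with ℓ ℕ.≟ q
  ... | yes _ = eulerFactor q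
  ... | no _ = 1ℚ

  factorAt-≢ : ∀ {q ℓ} → ℓ ≢ q → factorAt q ℓ ≡ 1ℚ
  factorAt-≢ {q} {ℓ} ℓ≢q with ℓ ℕ.≟ q
  ... | yes ℓ≡q = ⊥-elim (ℓ≢q ℓ≡q)
  ... | no _ = refl

  factorAt-≡ : ∀ q → factorAt q q ≡ eulerFactor q
  factorAt-≡ q with q ℕ.≟ q
  ... | yes _ = refl
  ... | no q≢q = ⊥-elim (q≢q refl)

  ∏[1…]-factorAt-< : ∀ {q} K → K < q → ∏[1… K ] (factorAt q) ≡ 1ℚ
  ∏[1…]-factorAt-< zero _ = refl
  ∏[1…]-factorAt-< {q} (suc K) K<q = begin
      ∏[1… suc K ] (factorAt q)                 ≡⟨ ∏[1…]-suc K (factorAt q) ⟩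
      ∏[1… K ] (factorAt q) * factorAt q (suc K) ≡⟨ cong₂ _*_ (∏[1…]-factorAt-< K (ℕP.<-trans (ℕP.n<1+n K) K<q)) (factorAt-≢ (ℕP.<⇒≢ K<q)) ⟩
      1ℚ * 1ℚ                                    ≡⟨⟩
      1ℚ                                         ∎
    where open ≡-Reasoning

  ∏[1…]-factorAt-≥ : ∀ {q} K → q ≤ K → 1 ≤ q → ∏[1… K ] (factorAt q) ≡ eulerFactor q
  ∏[1…]-factorAt-≥ zero q≤0 1≤q = ⊥-elim (ℕP.<⇒≱ 1≤q q≤0)
  ∏[1…]-factorAt-≥ {q} (suc K) q≤1+K 1≤q with q ℕ.≟ suc K
  ... | yes refl = begin
      ∏[1… suc K ] (factorAt q)              ≡⟨ ∏[1…]-suc K (factorAt q) ⟩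
      ∏[1… K ] (factorAt q) * factorAt q q  ≡⟨ cong₂ _*_ (∏[1…]-factorAt-< K ℕP.≤-refl) (factorAt-≡ q) ⟩
      1ℚ * eulerFactor q                     ≡⟨ ℚP.*-identityˡ _ ⟩
      eulerFactor q                          ∎
    where open ≡-Reasoning
  ... | no q≢1+K = begin
      ∏[1… suc K ] (factorAt q)                  ≡⟨ ∏[1…]-suc K (factorAt q) ⟩
      ∏[1… K ] (factorAt q) * factorAt q (suc K) ≡⟨ cong₂ _*_ (∏[1…]-factorAt-≥ K q≤K 1≤q) (factorAt-≢ (q≢1+K ∘ sym)) ⟩
      eulerFactor q * 1ℚ                         ≡⟨ ℚP.*-identityʳ _ ⟩
      eulerFactor q                              ∎
    where
    open ≡-Reasoning
    q≤K = ℕP.≤-pred (ℕP.≤∧≢⇒< q≤1+K q≢1+K)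

  module _ {p : ℕ} (p-prime : Prime p) where

    prime∣p^k⇒≡p : ∀ {ℓ} k → Prime ℓ → ℓ ∣ p ℕ.^ k → ℓ ≡ p
    prime∣p^k⇒≡p zero ℓ-prime ℓ∣1 = ⊥-elim (¬prime[1] (subst Prime (∣1⇒≡1 ℓ∣1) ℓ-prime))
    prime∣p^k⇒≡p (suc k) ℓ-prime ℓ∣p^1+k with euclidsLemma p (p ℕ.^ k) ℓ-prime ℓ∣p^1+k
    ... | inj₂ ℓ∣p^k = prime∣p^k⇒≡p k ℓ-prime ℓ∣p^k
    ... | inj₁ ℓ∣p with prime⇒irreducible p-prime ℓ∣p
    ...   | inj₁ ℓ≡1 = ⊥-elim (¬prime[1] (subst Prime ℓ≡1 ℓ-prime))
    ...   | inj₂ ℓ≡p = ℓ≡p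

    module _ (k N : ℕ) (p∤N : ¬ p ∣ N) where

      ψ-factor-split : ∀ ℓ → ψ-factor (p ℕ.^ suc k ℕ.* N) ℓ ≡ ψ-factor N ℓ * factorAt p ℓ
      ψ-factor-split ℓ with prime? ℓ | ℓ ∣? (p ℕ.^ suc k ℕ.* N) | ℓ ∣? N | ℓ ℕ.≟ p
      ... | no ℓ-composite | _ | _ | yes refl = ⊥-elim (ℓ-composite p-prime)
      ... | no _ | _ | _ | no _ = refl
      ... | yes _ | _ | yes p∣N | yes refl = ⊥-elim (p∤N p∣N)
      ... | yes _ | no p∤M | no _ | yes refl = ⊥-elim (p∤M (∣-trans (m∣m*n (p ℕ.^ k)) (m∣m*n N)))
      ... | yes _ | yes _ | no _ | yes refl = sym (ℚP.*-identityˡ _)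
      ... | yes _ | yes _ | yes _ | no _ = sym (ℚP.*-identityʳ _)
      ... | yes _ | no _ | no _ | no _ = refl
      ... | yes _ | no ℓ∤M | yes ℓ∣N | no _ = ⊥-elim (ℓ∤M (∣-trans ℓ∣N (n∣m*n (p ℕ.^ suc k))))
      ... | yes ℓ-prime | yes ℓ∣M | no ℓ∤N | no ℓ≢p with euclidsLemma (p ℕ.^ suc k) N ℓ-prime ℓ∣M
      ...   | inj₁ ℓ∣p^1+k = ⊥-elim (ℓ≢p (prime∣p^k⇒≡p (suc k) ℓ-prime ℓ∣p^1+k))
      ...   | inj₂ ℓ∣N = ⊥-elim (ℓ∤N ℓ∣N)

      ψ-p^[1+k]*N : ψ (p ℕ.^ suc k ℕ.* N) ≡ ℕ→ℚ (p ℕ.^ suc k) * eulerFactor p * ψ N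
      ψ-p^[1+k]*N = begin
          ψ M
            ≡⟨ ψ≡*∏[1…] M ⟩
          ℕ→ℚ M * ∏[1… M ] (ψ-factor M)
            ≡⟨ cong (ℕ→ℚ M *_) (∏-cong (applyUpTo suc M) ψ-factor-split) ⟩
          ℕ→ℚ M * ∏[1… M ] (λ ℓ → ψ-factor N ℓ * factorAt p ℓ)
            ≡⟨ cong (ℕ→ℚ M *_) (∏-* (ψ-factor N) (factorAt p) (applyUpTo suc M)) ⟩
          ℕ→ℚ M * (∏[1… M ] (ψ-factor N) * ∏[1… M ] (factorAt p))
            ≡⟨ cong (ℕ→ℚ M *_) (cong₂ _*_ ∏-N ∏-p) ⟩
          ℕ→ℚ M * (∏[1… N ] (ψ-factor N) * eulerFactor p)
            ≡⟨ cong (_* (∏[1… N ] (ψ-factor N) * eulerFactor p)) (ℕ→ℚ-* (p ℕ.^ suc k) N) ⟩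
          ℕ→ℚ (p ℕ.^ suc k) * ℕ→ℚ N * (∏[1… N ] (ψ-factor N) * eulerFactor p)
            ≡⟨ regroup (ℕ→ℚ (p ℕ.^ suc k)) (ℕ→ℚ N) (∏[1… N ] (ψ-factor N)) (eulerFactor p) ⟩
          ℕ→ℚ (p ℕ.^ suc k) * eulerFactor p * (ℕ→ℚ N * ∏[1… N ] (ψ-factor N))
            ≡⟨ cong (ℕ→ℚ (p ℕ.^ suc k) * eulerFactor p *_) (ψ≡*∏[1…] N) ⟨
          ℕ→ℚ (p ℕ.^ suc k) * eulerFactor p * ψ N ∎
        where
        open ≡-Reasoning
        M = p ℕ.^ suc k ℕ.* N
        regroup : ∀ a b c d → a * b * (c * d) ≡ a * d * (b * c)
        regroup = solve-∀ ℚ-ring-for-solver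
        instance
          p≢0 = prime⇒nonZero p-prime
          N≢0 = ℕ.≢-nonZero (λ { refl → p∤N (p ∣0) })
          M≢0 = ℕP.m*n≢0 (p ℕ.^ suc k) N {{ℕP.m^n≢0 p (suc k)}}
        p≤M : p ≤ M
        p≤M = ∣⇒≤ (∣-trans (m∣m*n (p ℕ.^ k)) (m∣m*n N))
        N≤M : N ≤ M
        N≤M = ∣⇒≤ (n∣m*n (p ℕ.^ suc k))
        trivial-beyond-N : ∀ ℓ → N < ℓ → ψ-factor N ℓ ≡ 1ℚ
        trivial-beyond-N ℓ N<ℓ with prime? ℓ | ℓ ∣? N
        ... | yes _ | yes ℓ∣N = ⊥-elim (ℕP.<⇒≱ N<ℓ (∣⇒≤ ℓ∣N))
        ... | yes _ | no _ = refl
        ... | no _ | _ = refl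
        ∏-N : ∏[1… M ] (ψ-factor N) ≡ ∏[1… N ] (ψ-factor N)
        ∏-N = trans (cong (λ K → ∏[1… K ] (ψ-factor N)) (sym (ℕP.m∸n+n≡m N≤M))) (∏[1…]-stable N (M ℕ.∸ N) (ψ-factor N) trivial-beyond-N)
        ∏-p : ∏[1… M ] (factorAt p) ≡ eulerFactor p
        ∏-p = ∏[1…]-factorAt-≥ M p≤M (ℕ.>-nonZero⁻¹ p)

  κ : ℕ → ℚ
  κ Nₚ = ψ Nₚ * (1ℚ ⊘ ℕ→ℚ 24)

module Combinations where
  import Data.Integer as ℤ
  open import Data.Rational as ℚ using (ℚ; 0ℚ; _+_; _*_)
  import Data.Rational.Properties as ℚP
  open import Data.List using (List; []; _∷_; _++_; map)
  open import Data.List.Relation.Unary.All as All using (All; []; _∷_)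
  open import Data.Product using (proj₁; map₂)
  open import Function using (_∘_)
  import Algebra.Module.Construct.TensorUnit as TensorUnit
  open import Relation.Binary.PropositionalEquality as ≡ using (_≡_)
  import Relation.Binary.Reasoning.Setoid as SetoidReasoning
  open RationalArithmetic

  -- A formal combination Σ q · X̂^a, listed by its terms (a , q).
  Combination : Set
  Combination = List (ℤ × ℚ)

  scale : ℚ → Combination → Combination
  scale c = map (map₂ (c *_))

  module Evaluation (M : Module ℚ-ring 0ℓ 0ℓ) where
    open Module M
    open SetoidReasoning ≈ᴹ-setoid

    eval : (ℤ → Carrierᴹ) → Combination → Carrierᴹ
    eval X [] = 0ᴹ
    eval X ((a , q) ∷ xs) = q *ₗ X a +ᴹ eval X xs

    eval-++ : ∀ X xs ys → eval X (xs ++ ys) ≈ᴹ eval X xs +ᴹ eval X ys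
    eval-++ X [] ys = ≈ᴹ-sym (+ᴹ-identityˡ (eval X ys))
    eval-++ X ((a , q) ∷ xs) ys = ≈ᴹ-trans (+ᴹ-congˡ (eval-++ X xs ys)) (≈ᴹ-sym (+ᴹ-assoc _ _ _))

    eval-scale : ∀ X c xs → eval X (scale c xs) ≈ᴹ c *ₗ eval X xs
    eval-scale X c [] = ≈ᴹ-sym (*ₗ-zeroʳ c)
    eval-scale X c ((a , q) ∷ xs) = begin
        (c * q) *ₗ X a +ᴹ eval X (scale c xs)  ≈⟨ +ᴹ-cong (*ₗ-assoc c q (X a)) (eval-scale X c xs) ⟩
        c *ₗ (q *ₗ X a) +ᴹ c *ₗ eval X xs      ≈⟨ *ₗ-distribˡ c _ _ ⟨
        c *ₗ (q *ₗ X a +ᴹ eval X xs)           ∎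

    eval-cong : ∀ {X Y} xs → All (λ x → X (proj₁ x) ≈ᴹ Y (proj₁ x)) xs → eval X xs ≈ᴹ eval Y xs
    eval-cong [] [] = ≈ᴹ-refl
    eval-cong (_ ∷ xs) (Xa≈Ya ∷ rest) = +ᴹ-cong (*ₗ-congˡ Xa≈Ya) (eval-cong xs rest)

    eval-+ᴹ : ∀ X Y xs → eval (λ a → X a +ᴹ Y a) xs ≈ᴹ eval X xs +ᴹ eval Y xs
    eval-+ᴹ X Y [] = ≈ᴹ-sym (+ᴹ-identityˡ 0ᴹ)
    eval-+ᴹ X Y ((a , q) ∷ xs) = begin
        q *ₗ (X a +ᴹ Y a) +ᴹ eval (λ b → X b +ᴹ Y b) xs     ≈⟨ +ᴹ-cong (*ₗ-distribˡ q (X a) (Y a)) (eval-+ᴹ X Y xs) ⟩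
        (q *ₗ X a +ᴹ q *ₗ Y a) +ᴹ (eval X xs +ᴹ eval Y xs)  ≈⟨ interchange ⟩
        (q *ₗ X a +ᴹ eval X xs) +ᴹ (q *ₗ Y a +ᴹ eval Y xs)  ∎
      where
      interchange : ∀ {u v w z} → (u +ᴹ v) +ᴹ (w +ᴹ z) ≈ᴹ (u +ᴹ w) +ᴹ (v +ᴹ z)
      interchange {u} {v} {w} {z} = begin
        (u +ᴹ v) +ᴹ (w +ᴹ z)  ≈⟨ +ᴹ-assoc u v _ ⟩
        u +ᴹ (v +ᴹ (w +ᴹ z))  ≈⟨ +ᴹ-congˡ (+ᴹ-assoc v w z) ⟨
        u +ᴹ ((v +ᴹ w) +ᴹ z)  ≈⟨ +ᴹ-congˡ (+ᴹ-congʳ (+ᴹ-comm v w)) ⟩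
        u +ᴹ ((w +ᴹ v) +ᴹ z)  ≈⟨ +ᴹ-congˡ (+ᴹ-assoc w v z) ⟩
        u +ᴹ (w +ᴹ (v +ᴹ z))  ≈⟨ +ᴹ-assoc u w _ ⟨
        (u +ᴹ w) +ᴹ (v +ᴹ z)  ∎

  module _ (M N : Module ℚ-ring 0ℓ 0ℓ) where
    private
      module M = Module M
      module N = Module N
    open Evaluation
    open SetoidReasoning N.≈ᴹ-setoid

    eval-linear : (f : M.Carrierᴹ → N.Carrierᴹ) →
      (∀ {x y} → x M.≈ᴹ y → f x N.≈ᴹ f y) → (∀ x y → f (x M.+ᴹ y) N.≈ᴹ f x N.+ᴹ f y) →
      (∀ c x → f (c M.*ₗ x) N.≈ᴹ c N.*ₗ f x) →
      ∀ X xs → f (eval M X xs) N.≈ᴹ eval N (f ∘ X) xs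
    eval-linear f f-cong f-+ f-* X [] = begin
        f M.0ᴹ              ≈⟨ f-cong (M.*ₗ-zeroˡ M.0ᴹ) ⟨
        f (0ℚ M.*ₗ M.0ᴹ)    ≈⟨ f-* 0ℚ M.0ᴹ ⟩
        0ℚ N.*ₗ f M.0ᴹ      ≈⟨ N.*ₗ-zeroˡ (f M.0ᴹ) ⟩
        N.0ᴹ                ∎
    eval-linear f f-cong f-+ f-* X ((a , q) ∷ xs) = begin
        f (q M.*ₗ X a M.+ᴹ eval M X xs)      ≈⟨ f-+ _ _ ⟩
        f (q M.*ₗ X a) N.+ᴹ f (eval M X xs)  ≈⟨ N.+ᴹ-cong (f-* q (X a)) (eval-linear f f-cong f-+ f-* X xs) ⟩
        q N.*ₗ f (X a) N.+ᴹ eval N (f ∘ X) xs ∎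

  ℚ-module : Module ℚ-ring 0ℓ 0ℓ
  ℚ-module = TensorUnit.⟨module⟩

  Σ⟨_⟩ : Combination → (ℤ → ℚ) → ℚ
  Σ⟨ xs ⟩ f = Evaluation.eval ℚ-module f xs

  gram : (ℤ → ℤ → ℚ) → Combination → Combination → ℚ
  gram g xs ys = Σ⟨ xs ⟩ (λ a → Σ⟨ ys ⟩ (g a))

  module _ where
    open Evaluation ℚ-module

    Σ-++ : ∀ xs ys f → Σ⟨ xs ++ ys ⟩ f ≡ Σ⟨ xs ⟩ f + Σ⟨ ys ⟩ f
    Σ-++ xs ys f = eval-++ f xs ys

    Σ-scale : ∀ c xs f → Σ⟨ scale c xs ⟩ f ≡ c * Σ⟨ xs ⟩ f
    Σ-scale c xs f = eval-scale f c xs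

    Σ-congᴬ : ∀ xs {f g} → All (λ x → f (proj₁ x) ≡ g (proj₁ x)) xs → Σ⟨ xs ⟩ f ≡ Σ⟨ xs ⟩ g
    Σ-congᴬ xs = eval-cong xs

    Σ-cong : ∀ xs {f g} → (∀ a → f a ≡ g a) → Σ⟨ xs ⟩ f ≡ Σ⟨ xs ⟩ g
    Σ-cong xs f≗g = eval-cong xs (All.universal (f≗g ∘ proj₁) xs)

    Σ-+ : ∀ xs f g → Σ⟨ xs ⟩ (λ a → f a + g a) ≡ Σ⟨ xs ⟩ f + Σ⟨ xs ⟩ g
    Σ-+ xs f g = eval-+ᴹ f g xs

    Σ-* : ∀ c xs f → Σ⟨ xs ⟩ (λ a → c * f a) ≡ c * Σ⟨ xs ⟩ f
    Σ-* c xs f = ≡.sym (eval-linear ℚ-module ℚ-module (c *_) (≡.cong (c *_)) (ℚP.*-distribˡ-+ c) c*-commutes f xs)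
      where
      c*-commutes : ∀ d x → c * (d * x) ≡ d * (c * x)
      c*-commutes d x = ≡.trans (≡.sym (ℚP.*-assoc c d x)) (≡.trans (≡.cong (_* x) (ℚP.*-comm c d)) (ℚP.*-assoc d c x))

    Σ-zero : ∀ xs → Σ⟨ xs ⟩ (λ _ → 0ℚ) ≡ 0ℚ
    Σ-zero [] = ≡.refl
    Σ-zero ((a , q) ∷ xs) = ≡.cong₂ _+_ (ℚP.*-zeroʳ q) (Σ-zero xs)

    Σ-comm : ∀ xs ys (h : ℤ → ℤ → ℚ) → Σ⟨ xs ⟩ (λ a → Σ⟨ ys ⟩ (h a)) ≡ Σ⟨ ys ⟩ (λ b → Σ⟨ xs ⟩ (λ a → h a b))
    Σ-comm [] ys h = ≡.sym (Σ-zero ys)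
    Σ-comm ((a , q) ∷ xs) ys h = begin
        q * Σ⟨ ys ⟩ (h a) + Σ⟨ xs ⟩ (λ a′ → Σ⟨ ys ⟩ (h a′))
          ≡⟨ ≡.cong₂ _+_ (Σ-* q ys (h a)) (≡.sym (Σ-comm xs ys h)) ⟨
        Σ⟨ ys ⟩ (λ b → q * h a b) + Σ⟨ ys ⟩ (λ b → Σ⟨ xs ⟩ (λ a′ → h a′ b))
          ≡⟨ Σ-+ ys _ _ ⟨
        Σ⟨ ys ⟩ (λ b → q * h a b + Σ⟨ xs ⟩ (λ a′ → h a′ b)) ∎
      where open ≡.≡-Reasoning

  gram-sym : ∀ {g} → (∀ a b → g a b ≡ g b a) → ∀ xs ys → gram g xs ys ≡ gram g ys xs
  gram-sym g-sym xs ys = ≡.trans (Σ-comm xs ys _) (Σ-cong ys (λ b → Σ-cong xs (λ a → g-sym a b)))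

module ComponentIndices where
  open import Data.Nat as ℕ using (_<_; z≤n; s≤s)
  import Data.Nat.Properties as ℕP
  open import Data.Nat.Divisibility using (m∣m*n; _∣0)
  open import Data.Integer as ℤ using (+_; -[1+_]; _⊖_)
  import Data.Integer.Properties as ℤP
  import Data.Integer.Tactic.RingSolver as ℤ-Solver
  open import Data.List using (_∷_; _++_; map; upTo; applyUpTo; [_])
  import Data.List.Properties as ListP
  open import Data.List.Relation.Unary.All as All using (All; _∷_)
  import Data.List.Relation.Unary.All.Properties as AllP
  open import Data.Sum using (inj₁; inj₂)
  open import Function using (_∘_)
  open import Relation.Binary.PropositionalEquality hiding ([_])
  open Combinations

  innerIndex : ℕ → ℕ → ℤ
  innerIndex n k = + n ℤ.- + (2 ℕ.* suc k)

  innerIndices≡applyUpTo : ∀ n → innerIndices ℚ-module n ≡ applyUpTo (innerIndex n) (n ℕ.∸ 1)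
  innerIndices≡applyUpTo n = ListP.map-upTo (innerIndex n) (n ℕ.∸ 1)

  ∣⊖∣≤+ : ∀ j k → ℤ.∣ j ⊖ k ∣ ≤ j ℕ.+ k
  ∣⊖∣≤+ j k with ℕP.≤-total j k
  ... | inj₁ j≤k = begin
      ℤ.∣ j ⊖ k ∣  ≡⟨ ℤP.∣⊖∣-≤ j≤k ⟩
      k ℕ.∸ j      ≤⟨ ℕP.m∸n≤m k j ⟩
      k            ≤⟨ ℕP.m≤n+m k j ⟩
      j ℕ.+ k      ∎
    where open ℕP.≤-Reasoning
  ... | inj₂ k≤j = begin
      ℤ.∣ j ⊖ k ∣  ≡⟨ ℤP.∣m⊖n∣≡∣n⊖m∣ j k ⟩
      ℤ.∣ k ⊖ j ∣  ≡⟨ ℤP.∣⊖∣-≤ k≤j ⟩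
      j ℕ.∸ k      ≤⟨ ℕP.m∸n≤m j k ⟩
      j            ≤⟨ ℕP.m≤m+n j k ⟩
      j ℕ.+ k      ∎
    where open ℕP.≤-Reasoning

  innerIndex-small : ∀ {n k} → 2 ℕ.+ k ≤ n → ℤ.∣ innerIndex n k ∣ ℕ.+ 2 ≤ n
  innerIndex-small {n} {k} 2+k≤n with ℕP.m≤n⇒∃[o]m+o≡n 2+k≤n
  ... | j , refl = begin
      ℤ.∣ innerIndex (2 ℕ.+ k ℕ.+ j) k ∣ ℕ.+ 2  ≡⟨ cong (λ i → ℤ.∣ i ∣ ℕ.+ 2) (as-difference (+ k) (+ j)) ⟩
      ℤ.∣ + j ℤ.- + k ∣ ℕ.+ 2                  ≡⟨ cong (λ i → ℤ.∣ i ∣ ℕ.+ 2) (ℤP.m-n≡m⊖n j k) ⟩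
      ℤ.∣ j ⊖ k ∣ ℕ.+ 2                        ≤⟨ ℕP.+-monoˡ-≤ 2 (∣⊖∣≤+ j k) ⟩
      j ℕ.+ k ℕ.+ 2                            ≡⟨ reorder j k ⟩
      2 ℕ.+ k ℕ.+ j                            ∎
    where
    open ℕP.≤-Reasoning
    as-difference : ∀ k j → (+ 2 ℤ.+ k ℤ.+ j) ℤ.- ((+ 1 ℤ.+ k) ℤ.+ ((+ 1 ℤ.+ k) ℤ.+ + 0)) ≡ j ℤ.- k
    as-difference = ℤ-Solver.solve-∀
    reorder : ∀ j k → j ℕ.+ k ℕ.+ 2 ≡ 2 ℕ.+ k ℕ.+ j
    reorder j k = trans (ℕP.+-comm (j ℕ.+ k) 2) (cong (2 ℕ.+_) (ℕP.+-comm j k))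

  ∣i∣≤n⇒-n≤i : ∀ {i n} → ℤ.∣ i ∣ ≤ n → ℤ.- + n ℤ.≤ i
  ∣i∣≤n⇒-n≤i {+ _} _ = ℤP.neg-≤-pos
  ∣i∣≤n⇒-n≤i { -[1+ _ ]} ∣i∣≤n = ℤP.neg-mono-≤ (ℤ.+≤+ ∣i∣≤n)

  ∣i∣≤n⇒i≤n : ∀ {i n} → ℤ.∣ i ∣ ≤ n → i ℤ.≤ + n
  ∣i∣≤n⇒i≤n {+ _} ∣i∣≤n = ℤ.+≤+ ∣i∣≤n
  ∣i∣≤n⇒i≤n { -[1+ _ ]} _ = ℤ.-≤+

  innerIndex-valid : ∀ {n k} → 2 ℕ.+ k ≤ n → Valid n (innerIndex n k)
  innerIndex-valid {n} {k} 2+k≤n = ∣i∣≤n⇒-n≤i ∣a∣≤n , ∣i∣≤n⇒i≤n ∣a∣≤n , 2∣∣a-n∣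
    where
    ∣a∣≤n = ℕP.≤-trans (ℕP.m≤m+n _ 2) (innerIndex-small 2+k≤n)
    cancel : ∀ n y → (n ℤ.- y) ℤ.- n ≡ ℤ.- y
    cancel = ℤ-Solver.solve-∀
    2∣∣a-n∣ : 2 ∣ ℤ.∣ innerIndex n k ℤ.- + n ∣
    2∣∣a-n∣ rewrite cancel (+ n) (+ (2 ℕ.* suc k)) = m∣m*n (suc k)

  <∸1⇒2+≤ : ∀ {k} n → k < n ℕ.∸ 1 → 2 ℕ.+ k ≤ n
  <∸1⇒2+≤ (suc n) k<n = s≤s k<n

  innerIndices-small : ∀ n → All (λ a → ℤ.∣ a ∣ ℕ.+ 2 ≤ n) (innerIndices ℚ-module n)
  innerIndices-small n = subst (All _) (sym (innerIndices≡applyUpTo n))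
    (AllP.applyUpTo⁺₁ (innerIndex n) (n ℕ.∸ 1) (innerIndex-small ∘ <∸1⇒2+≤ n))

  innerIndices-valid : ∀ n → All (Valid n) (innerIndices ℚ-module n)
  innerIndices-valid n = subst (All _) (sym (innerIndices≡applyUpTo n))
    (AllP.applyUpTo⁺₁ (innerIndex n) (n ℕ.∸ 1) (innerIndex-valid ∘ <∸1⇒2+≤ n))

  +n-valid : ∀ n → Valid n (+ n)
  +n-valid n = ℤP.neg-≤-pos , ℤP.≤-refl , subst (λ i → 2 ∣ ℤ.∣ i ∣) (sym (ℤP.+-inverseʳ (+ n))) (2 ∣0)

  -n-valid : ∀ n → Valid n (ℤ.- + n)
  -n-valid n = ℤP.≤-refl , ℤP.neg-≤-pos , 2∣∣-2n∣
    where
    double : ∀ n → ℤ.- n ℤ.- n ≡ ℤ.- (+ 2 ℤ.* n)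
    double = ℤ-Solver.solve-∀
    2∣∣-2n∣ : 2 ∣ ℤ.∣ ℤ.- (+ n) ℤ.- + n ∣
    2∣∣-2n∣ rewrite double (+ n) | sym (ℤP.pos-* 2 n) | ℤP.∣-i∣≡∣i∣ (+ (2 ℕ.* n)) = m∣m*n n

  innerIndices-step : ∀ m → innerIndices ℚ-module (3 ℕ.+ m) ≡ + suc m ∷ (innerIndices ℚ-module (suc m) ++ [ -[1+ m ] ])
  innerIndices-step m = begin
      map idx₃ (upTo (2 ℕ.+ m))                              ≡⟨⟩
      idx₃ 0 ∷ map idx₃ (applyUpTo suc (suc m))              ≡⟨ cong (λ is → idx₃ 0 ∷ map idx₃ is) (ListP.applyUpTo-∷ʳ suc m) ⟨
      idx₃ 0 ∷ map idx₃ (applyUpTo suc m ++ [ suc m ])       ≡⟨ cong (idx₃ 0 ∷_) (ListP.map-++ idx₃ (applyUpTo suc m) [ suc m ]) ⟩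
      + suc m ∷ (map idx₃ (applyUpTo suc m) ++ [ idx₃ (suc m) ]) ≡⟨ cong₂ (λ is i → + suc m ∷ (is ++ [ i ])) shifted last ⟩
      + suc m ∷ (map idx₁ (upTo m) ++ [ -[1+ m ] ])          ∎
    where
    open ≡-Reasoning
    idx₃ = innerIndex (3 ℕ.+ m)
    idx₁ = innerIndex (suc m)
    via-ℤ-product : ∀ n k → innerIndex n k ≡ + n ℤ.- + 2 ℤ.* + suc k
    via-ℤ-product n k = cong (λ i → + n ℤ.- i) (ℤP.pos-* 2 (suc k))
    shift : ∀ m k → (+ 2 ℤ.+ m) ℤ.- + 2 ℤ.* (+ 1 ℤ.+ k) ≡ m ℤ.- + 2 ℤ.* k
    shift = ℤ-Solver.solve-∀
    shifted : map idx₃ (applyUpTo suc m) ≡ map idx₁ (upTo m)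
    shifted = begin
      map idx₃ (applyUpTo suc m)  ≡⟨ ListP.map-applyUpTo suc idx₃ m ⟩
      applyUpTo (idx₃ ∘ suc) m    ≡⟨ ListP.map-upTo (idx₃ ∘ suc) m ⟨
      map (idx₃ ∘ suc) (upTo m)   ≡⟨ ListP.map-cong (λ k → trans (via-ℤ-product (3 ℕ.+ m) (suc k))
                                       (trans (shift (+ suc m) (+ suc k)) (sym (via-ℤ-product (suc m) k)))) (upTo m) ⟩
      map idx₁ (upTo m)           ∎
    flip : ∀ m → (+ 2 ℤ.+ m) ℤ.- + 2 ℤ.* (+ 1 ℤ.+ m) ≡ ℤ.- m
    flip = ℤ-Solver.solve-∀
    last : idx₃ (suc m) ≡ -[1+ m ]
    last = trans (via-ℤ-product (3 ℕ.+ m) (suc m)) (flip (+ suc m))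

  +2≤⇒≢ : ∀ {n x} → x ℕ.+ 2 ≤ n → x ≢ n
  +2≤⇒≢ {x = x} x+2≤n refl = ℕP.<-irrefl refl (ℕP.<-≤-trans (ℕP.m<m+n x (s≤s z≤n)) x+2≤n)

  small⇒≢ : ∀ {n a b} → ℤ.∣ b ∣ ℕ.+ 2 ≤ n → ℤ.∣ a ∣ ≡ n → a ≢ b
  small⇒≢ small ∣a∣≡n refl = +2≤⇒≢ small ∣a∣≡n

module InnerCombination (p : ℕ) (1≤p : 1 ≤ p) where
  import Data.Nat as ℕ
  import Data.Nat.Properties as ℕP
  import Data.Nat.DivMod as ℕD
  open import Data.Integer as ℤ using (+_; -[1+_])
  open import Data.Rational as ℚ using (ℚ; 0ℚ; 1ℚ; ½; _+_; _*_; -_; _-_)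
  import Data.Rational.Properties as ℚP
  open import Data.List using ([]; _∷_; _++_; map; [_])
  import Data.List.Properties as ListP
  open import Data.List.Relation.Unary.All as All using (All; []; _∷_)
  import Data.List.Relation.Unary.All.Properties as AllP
  open import Data.Product using (proj₁; map₂)
  open import Function using (_∘_)
  open import Relation.Binary.PropositionalEquality hiding ([_])
  open RationalArithmetic
  open Combinations
  open ComponentIndices

  P : ℚ
  P = ℕ→ℚ p

  -- innerIndices and innerCoeff of Defs do not use their module argument.
  coeff : ℕ → ℤ → ℚ
  coeff = innerCoeff ℚ-module p

  inner : ℕ → Combination
  inner n = map (λ a → a , coeff n a) (innerIndices ℚ-module n)

  halfExponent-shift : ∀ n {x} → x ℕ.+ 2 ≤ n →
    (2 ℕ.+ n ℕ.∸ x) ℕD./ 2 ℕ.∸ 1 ≡ suc ((n ℕ.∸ x) ℕD./ 2 ℕ.∸ 1)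
  halfExponent-shift n {x} x+2≤n = begin
      (2 ℕ.+ n ℕ.∸ x) ℕD./ 2 ℕ.∸ 1    ≡⟨ cong (λ y → y ℕD./ 2 ℕ.∸ 1) (ℕP.+-∸-assoc 2 x≤n) ⟩
      (2 ℕ.+ d) ℕD./ 2 ℕ.∸ 1          ≡⟨ cong (ℕ._∸ 1) (ℕD.m/n≡1+[m∸n]/n {2 ℕ.+ d} {2} (ℕP.m≤m+n 2 d)) ⟩
      d ℕD./ 2                        ≡⟨ ℕP.suc-pred (d ℕD./ 2) {{ℕ.>-nonZero (ℕD.m≥n⇒m/n>0 2≤d)}} ⟨
      suc (d ℕD./ 2 ℕ.∸ 1)            ∎
    where
    open ≡-Reasoning
    d = n ℕ.∸ x
    x≤n = ℕP.≤-trans (ℕP.m≤m+n x 2) x+2≤n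
    2≤d : 2 ≤ d
    2≤d = subst (_≤ d) (ℕP.m+n∸n≡m 2 x) (ℕP.∸-monoˡ-≤ x (subst (_≤ n) (ℕP.+-comm x 2) x+2≤n))

  coeff-shift : ∀ n a → ℤ.∣ a ∣ ℕ.+ 2 ≤ n → coeff (2 ℕ.+ n) a ≡ P * coeff n a
  coeff-shift n a small = begin
      (a ℚ./ 2) * ℕ→ℚ (p ℕ.^ ((2 ℕ.+ n ℕ.∸ ℤ.∣ a ∣) ℕD./ 2 ℕ.∸ 1) ℕ.* (p ℕ.∸ 1))
        ≡⟨ cong (λ e → (a ℚ./ 2) * ℕ→ℚ (p ℕ.^ e ℕ.* (p ℕ.∸ 1))) (halfExponent-shift n small) ⟩
      (a ℚ./ 2) * ℕ→ℚ (p ℕ.* p ℕ.^ e ℕ.* (p ℕ.∸ 1))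
        ≡⟨ cong ((a ℚ./ 2) *_) (trans (cong ℕ→ℚ (ℕP.*-assoc p (p ℕ.^ e) (p ℕ.∸ 1))) (ℕ→ℚ-* p (p ℕ.^ e ℕ.* (p ℕ.∸ 1)))) ⟩
      (a ℚ./ 2) * (P * ℕ→ℚ (p ℕ.^ e ℕ.* (p ℕ.∸ 1)))
        ≡⟨ exchange (a ℚ./ 2) P (ℕ→ℚ (p ℕ.^ e ℕ.* (p ℕ.∸ 1))) ⟩
      P * coeff n a  ∎
    where
    open ≡-Reasoning
    e = (n ℕ.∸ ℤ.∣ a ∣) ℕD./ 2 ℕ.∸ 1
    exchange : ∀ x y z → x * (y * z) ≡ y * (x * z)
    exchange = solve-∀ ℚ-ring-for-solver

  edgeCoeff : ℕ → ℚ
  edgeCoeff m = ℕ→ℚ (suc m) * ½ * (P - 1ℚ)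

  coeff-edge : ∀ m → coeff (3 ℕ.+ m) (+ suc m) ≡ edgeCoeff m
  coeff-edge m = begin
      (+ suc m ℚ./ 2) * ℕ→ℚ (p ℕ.^ ((2 ℕ.+ suc m ℕ.∸ suc m) ℕD./ 2 ℕ.∸ 1) ℕ.* (p ℕ.∸ 1))
        ≡⟨ cong (λ d → (+ suc m ℚ./ 2) * ℕ→ℚ (p ℕ.^ (d ℕD./ 2 ℕ.∸ 1) ℕ.* (p ℕ.∸ 1))) (ℕP.m+n∸n≡m 2 (suc m)) ⟩
      (+ suc m ℚ./ 2) * ℕ→ℚ (1 ℕ.* (p ℕ.∸ 1))
        ≡⟨ cong₂ _*_ (/2≡*½ (+ suc m)) (trans (cong ℕ→ℚ (ℕP.*-identityˡ (p ℕ.∸ 1))) (ℕ→ℚ-pred 1≤p)) ⟩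
      edgeCoeff m ∎
    where open ≡-Reasoning

  coeff-edge⁻ : ∀ m → coeff (3 ℕ.+ m) -[1+ m ] ≡ - edgeCoeff m
  coeff-edge⁻ m = trans (sym (ℚP.neg-distribˡ-* (+ suc m ℚ./ 2) _)) (cong -_ (coeff-edge m))

  scale-inner : ∀ m → map (λ a → a , coeff (3 ℕ.+ m) a) (innerIndices ℚ-module (suc m)) ≡ scale P (inner (suc m))
  scale-inner m = begin
      map (λ a → a , coeff (3 ℕ.+ m) a) (innerIndices ℚ-module (suc m))
        ≡⟨ ListP.map-cong-local (All.map (λ {a} small → cong (a ,_) (coeff-shift (suc m) a small)) (innerIndices-small (suc m))) ⟩
      map (map₂ (P *_) ∘ (λ a → a , coeff (suc m) a)) (innerIndices ℚ-module (suc m))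
        ≡⟨ ListP.map-∘ (innerIndices ℚ-module (suc m)) ⟩
      scale P (inner (suc m)) ∎
    where open ≡-Reasoning

  inner-step : ∀ m → inner (3 ℕ.+ m) ≡ (+ suc m , edgeCoeff m) ∷ (scale P (inner (suc m)) ++ [ (-[1+ m ] , - edgeCoeff m) ])
  inner-step m = begin
      map entry (innerIndices ℚ-module (3 ℕ.+ m))
        ≡⟨ cong (map entry) (innerIndices-step m) ⟩
      entry (+ suc m) ∷ map entry (innerIndices ℚ-module (suc m) ++ [ -[1+ m ] ])
        ≡⟨ cong (entry (+ suc m) ∷_) (ListP.map-++ entry (innerIndices ℚ-module (suc m)) [ -[1+ m ] ]) ⟩
      entry (+ suc m) ∷ (map entry (innerIndices ℚ-module (suc m)) ++ [ entry -[1+ m ] ])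
        ≡⟨ cong (λ b → entry (+ suc m) ∷ (map entry (innerIndices ℚ-module (suc m)) ++ [ (-[1+ m ] , b) ])) (coeff-edge⁻ m) ⟩
      entry (+ suc m) ∷ (map entry (innerIndices ℚ-module (suc m)) ++ [ (-[1+ m ] , - edgeCoeff m) ])
        ≡⟨ cong₂ (λ t rest → t ∷ (rest ++ [ (-[1+ m ] , - edgeCoeff m) ])) (cong (+ suc m ,_) (coeff-edge m)) (scale-inner m) ⟩
      (+ suc m , edgeCoeff m) ∷ (scale P (inner (suc m)) ++ [ (-[1+ m ] , - edgeCoeff m) ]) ∎
    where
    open ≡-Reasoning
    entry : ℤ → ℤ × ℚ
    entry a = a , coeff (3 ℕ.+ m) a

  inner-2 : inner 2 ≡ [ (+ 0 , 0ℚ) ]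
  inner-2 = cong (λ q → [ (+ 0 , q) ]) (ℚP.*-zeroˡ (ℕ→ℚ (p ℕ.^ 0 ℕ.* (p ℕ.∸ 1))))

  Σ-inner-step : ∀ m f → Σ⟨ inner (3 ℕ.+ m) ⟩ f ≡
    edgeCoeff m * f (+ suc m) + (P * Σ⟨ inner (suc m) ⟩ f + (- edgeCoeff m * f -[1+ m ] + 0ℚ))
  Σ-inner-step m f = begin
      Σ⟨ inner (3 ℕ.+ m) ⟩ f
        ≡⟨ cong (λ xs → Σ⟨ xs ⟩ f) (inner-step m) ⟩
      edgeCoeff m * f (+ suc m) + Σ⟨ scale P (inner (suc m)) ++ [ (-[1+ m ] , - edgeCoeff m) ] ⟩ f
        ≡⟨ cong (λ x → edgeCoeff m * f (+ suc m) + x) (Σ-++ (scale P (inner (suc m))) _ f) ⟩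
      edgeCoeff m * f (+ suc m) + (Σ⟨ scale P (inner (suc m)) ⟩ f + (- edgeCoeff m * f -[1+ m ] + 0ℚ))
        ≡⟨ cong (λ x → edgeCoeff m * f (+ suc m) + (x + (- edgeCoeff m * f -[1+ m ] + 0ℚ))) (Σ-scale P (inner (suc m)) f) ⟩
      edgeCoeff m * f (+ suc m) + (P * Σ⟨ inner (suc m) ⟩ f + (- edgeCoeff m * f -[1+ m ] + 0ℚ)) ∎
    where open ≡-Reasoning

  outer : ℕ → Combination
  outer n = (+ n , + n ℚ./ 2) ∷ (ℤ.- + n , - (+ n ℚ./ 2)) ∷ []

  cycle : ℕ → Combination
  cycle n = outer n ++ inner n

  inner-small : ∀ n → All (λ x → ℤ.∣ proj₁ x ∣ ℕ.+ 2 ≤ n) (inner n)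
  inner-small n = AllP.map⁺ (innerIndices-small n)

  cycle-valid : ∀ n → All (Valid n ∘ proj₁) (cycle n)
  cycle-valid n = +n-valid n ∷ -n-valid n ∷ AllP.map⁺ (innerIndices-valid n)

module IntersectionNumbers (p : ℕ) (1≤p : 1 ≤ p) where
  open import Data.Nat as ℕ using (_<_)
  import Data.Nat.Properties as ℕP
  open import Data.Integer as ℤ using (+_; -[1+_])
  open import Data.Rational as ℚ using (ℚ; 0ℚ; 1ℚ; ½; _+_; _*_; -_; _-_)
  open import Data.List using (_++_)
  open import Data.List.Relation.Unary.All as All using (All)
  open import Relation.Binary.PropositionalEquality hiding ([_])
  open import Data.Product using (proj₁)
  open import Data.Empty using (⊥-elim)
  open import Relation.Nullary using (yes; no)
  open RationalArithmetic
  open Combinations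
  open ComponentIndices
  open InnerCombination p 1≤p

  -- ι a b = ⟨X̂^a, X̂^b⟩ / (ψ(N_p)/24 · log p) unless a = b = ±n; ιₙ n covers that case too.
  ιℕ : ℕ → ℕ → ℚ
  ιℕ a b with a ℕ.≟ b
  ... | yes _ = - (P ^ℚ a + P ^ℚ a)
  ... | no _ = (P - 1ℚ) * P ^ℚ (a ℕ.⊓ b)

  ι : ℤ → ℤ → ℚ
  ι (+ a) (+ b) = ιℕ a b
  ι (+ _) -[1+ _ ] = P - 1ℚ
  ι -[1+ _ ] (+ _) = P - 1ℚ
  ι -[1+ a ] -[1+ b ] = ιℕ (suc a) (suc b)

  ιℕ-diag : ∀ a → ιℕ a a ≡ - (P ^ℚ a + P ^ℚ a)
  ιℕ-diag a with a ℕ.≟ a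
  ... | yes _ = refl
  ... | no a≢a = ⊥-elim (a≢a refl)

  ιℕ-off : ∀ {a b} → a ≢ b → ιℕ a b ≡ (P - 1ℚ) * P ^ℚ (a ℕ.⊓ b)
  ιℕ-off {a} {b} a≢b with a ℕ.≟ b
  ... | yes a≡b = ⊥-elim (a≢b a≡b)
  ... | no _ = refl

  ιℕ-> : ∀ {a b} → b < a → ιℕ a b ≡ (P - 1ℚ) * P ^ℚ b
  ιℕ-> b<a = trans (ιℕ-off (ℕP.>⇒≢ b<a)) (cong (λ e → (P - 1ℚ) * P ^ℚ e) (ℕP.m≥n⇒m⊓n≡n (ℕP.<⇒≤ b<a)))

  ιℕ-sym : ∀ a b → ιℕ a b ≡ ιℕ b a
  ιℕ-sym a b with a ℕ.≟ b | b ℕ.≟ a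
  ... | yes refl | yes _ = refl
  ... | yes refl | no b≢a = ⊥-elim (b≢a refl)
  ... | no a≢b | yes refl = ⊥-elim (a≢b refl)
  ... | no _ | no _ = cong (λ e → (P - 1ℚ) * P ^ℚ e) (ℕP.⊓-comm a b)

  ι-sym : ∀ a b → ι a b ≡ ι b a
  ι-sym (+ a) (+ b) = ιℕ-sym a b
  ι-sym (+ _) -[1+ _ ] = refl
  ι-sym -[1+ _ ] (+ _) = refl
  ι-sym -[1+ a ] -[1+ b ] = ιℕ-sym (suc a) (suc b)

  rowFormula : ℚ → ℚ → ℚ
  rowFormula Q N = N * ½ * (P - 1ℚ) * (Q + 1ℚ) - P * Q + 1ℚ

  innerRowValue : ℕ → ℚ
  innerRowValue m = rowFormula (P ^ℚ m) (ℕ→ℚ (suc m))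

  Σ-inner-ι-above : ∀ m c → suc m ≤ c → Σ⟨ inner (suc m) ⟩ (ι (+ c)) ≡ innerRowValue m
  Σ-inner-ι-above zero c _ = vanishes P
    where
    vanishes : ∀ P → 0ℚ ≡ ℕ→ℚ 1 * ½ * (P - 1ℚ) * (1ℚ + 1ℚ) - P * 1ℚ + 1ℚ
    vanishes = solve-∀ ℚ-ring-for-solver
  Σ-inner-ι-above (suc zero) c _ = trans (cong (λ xs → Σ⟨ xs ⟩ (ι (+ c))) inner-2) (vanishes P (ι (+ c) (+ 0)))
    where
    vanishes : ∀ P x → 0ℚ * x + 0ℚ ≡ ℕ→ℚ 2 * ½ * (P - 1ℚ) * (P * 1ℚ + 1ℚ) - P * (P * 1ℚ) + 1ℚ
    vanishes = solve-∀ ℚ-ring-for-solver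
  Σ-inner-ι-above (suc (suc k)) c 3+k≤c = begin
      Σ⟨ inner (3 ℕ.+ k) ⟩ (ι (+ c))
        ≡⟨ Σ-inner-step k (ι (+ c)) ⟩
      edgeCoeff k * ιℕ c (suc k) + (P * Σ⟨ inner (suc k) ⟩ (ι (+ c)) + (- edgeCoeff k * (P - 1ℚ) + 0ℚ))
        ≡⟨ cong₂ (λ x y → edgeCoeff k * x + (P * y + (- edgeCoeff k * (P - 1ℚ) + 0ℚ)))
                 (ιℕ-> (ℕP.<-trans (ℕP.n<1+n (suc k)) 3+k≤c)) (Σ-inner-ι-above k c (ℕP.≤-trans (ℕP.n≤1+n (suc k)) (ℕP.<⇒≤ 3+k≤c))) ⟩
      edgeCoeff k * ((P - 1ℚ) * (P * P ^ℚ k)) + (P * innerRowValue k + (- edgeCoeff k * (P - 1ℚ) + 0ℚ))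
        ≡⟨ step P (P ^ℚ k) (ℕ→ℚ (suc k)) ⟩
      rowFormula (P ^ℚ (2 ℕ.+ k)) (ℕ→ℚ 2 + ℕ→ℚ (suc k))
        ≡⟨ cong (rowFormula (P ^ℚ (2 ℕ.+ k))) (ℕ→ℚ-+ 2 (suc k)) ⟨
      innerRowValue (suc (suc k)) ∎
    where
    open ≡-Reasoning
    step : ∀ P Q N →
      let c = N * ½ * (P - 1ℚ)
          F = λ Q N → N * ½ * (P - 1ℚ) * (Q + 1ℚ) - P * Q + 1ℚ
      in c * ((P - 1ℚ) * (P * Q)) + (P * F Q N + (- c * (P - 1ℚ) + 0ℚ)) ≡ F (P * (P * Q)) (ℕ→ℚ 2 + N)
    step = solve-∀ ℚ-ring-for-solver

  Σ-inner-ι-below : ∀ m c → m ≤ c → Σ⟨ inner (suc m) ⟩ (ι -[1+ c ]) ≡ - innerRowValue m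
  Σ-inner-ι-below zero c _ = vanishes P
    where
    vanishes : ∀ P → 0ℚ ≡ - (ℕ→ℚ 1 * ½ * (P - 1ℚ) * (1ℚ + 1ℚ) - P * 1ℚ + 1ℚ)
    vanishes = solve-∀ ℚ-ring-for-solver
  Σ-inner-ι-below (suc zero) c _ = trans (cong (λ xs → Σ⟨ xs ⟩ (ι -[1+ c ])) inner-2) (vanishes P (ι -[1+ c ] (+ 0)))
    where
    vanishes : ∀ P x → 0ℚ * x + 0ℚ ≡ - (ℕ→ℚ 2 * ½ * (P - 1ℚ) * (P * 1ℚ + 1ℚ) - P * (P * 1ℚ) + 1ℚ)
    vanishes = solve-∀ ℚ-ring-for-solver
  Σ-inner-ι-below (suc (suc k)) c 2+k≤c = begin
      Σ⟨ inner (3 ℕ.+ k) ⟩ (ι -[1+ c ])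
        ≡⟨ Σ-inner-step k (ι -[1+ c ]) ⟩
      edgeCoeff k * (P - 1ℚ) + (P * Σ⟨ inner (suc k) ⟩ (ι -[1+ c ]) + (- edgeCoeff k * ιℕ (suc c) (suc k) + 0ℚ))
        ≡⟨ cong₂ (λ x y → edgeCoeff k * (P - 1ℚ) + (P * y + (- edgeCoeff k * x + 0ℚ)))
                 (ιℕ-> (ℕP.m≤n⇒m≤1+n 2+k≤c)) (Σ-inner-ι-below k c (ℕP.≤-trans (ℕP.n≤1+n k) (ℕP.<⇒≤ 2+k≤c))) ⟩
      edgeCoeff k * (P - 1ℚ) + (P * - innerRowValue k + (- edgeCoeff k * ((P - 1ℚ) * (P * P ^ℚ k)) + 0ℚ))
        ≡⟨ step P (P ^ℚ k) (ℕ→ℚ (suc k)) ⟩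
      - rowFormula (P ^ℚ (2 ℕ.+ k)) (ℕ→ℚ 2 + ℕ→ℚ (suc k))
        ≡⟨ cong (λ N → - rowFormula (P ^ℚ (2 ℕ.+ k)) N) (ℕ→ℚ-+ 2 (suc k)) ⟨
      - innerRowValue (suc (suc k)) ∎
    where
    open ≡-Reasoning
    step : ∀ P Q N →
      let c = N * ½ * (P - 1ℚ)
          F = λ Q N → N * ½ * (P - 1ℚ) * (Q + 1ℚ) - P * Q + 1ℚ
      in c * (P - 1ℚ) + (P * - F Q N + (- c * ((P - 1ℚ) * (P * Q)) + 0ℚ)) ≡ - F (P * (P * Q)) (ℕ→ℚ 2 + N)
    step = solve-∀ ℚ-ring-for-solver

  geometric : ℕ → ℚ
  geometric zero = 0ℚ
  geometric (suc k) = 1ℚ + P * geometric k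

  innerGramFormula : ℚ → ℚ → ℚ → ℚ
  innerGramFormula Q N G = ℕ→ℚ 2 * G - ℕ→ℚ 2 * N + N * (P - 1ℚ) * Q - N * N * ½ * (P - 1ℚ) * (Q + 1ℚ)

  innerGramValue : ℕ → ℚ
  innerGramValue m = innerGramFormula (P ^ℚ m) (ℕ→ℚ (suc m)) (geometric (suc m))

  gram-inner : ∀ m → gram ι (inner (suc m)) (inner (suc m)) ≡ innerGramValue m
  gram-inner zero = vanishes P
    where
    vanishes : ∀ P → 0ℚ ≡ ℕ→ℚ 2 * (1ℚ + P * 0ℚ) - ℕ→ℚ 2 * ℕ→ℚ 1 + ℕ→ℚ 1 * (P - 1ℚ) * 1ℚ
                          - ℕ→ℚ 1 * ℕ→ℚ 1 * ½ * (P - 1ℚ) * (1ℚ + 1ℚ)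
    vanishes = solve-∀ ℚ-ring-for-solver
  gram-inner (suc zero) = trans (cong (λ xs → gram ι xs xs) inner-2) (vanishes P (ι (+ 0) (+ 0)))
    where
    vanishes : ∀ P x → 0ℚ * (0ℚ * x + 0ℚ) + 0ℚ ≡ ℕ→ℚ 2 * (1ℚ + P * (1ℚ + P * 0ℚ)) - ℕ→ℚ 2 * ℕ→ℚ 2
                        + ℕ→ℚ 2 * (P - 1ℚ) * (P * 1ℚ) - ℕ→ℚ 2 * ℕ→ℚ 2 * ½ * (P - 1ℚ) * (P * 1ℚ + 1ℚ)
    vanishes = solve-∀ ℚ-ring-for-solver
  gram-inner (suc (suc k)) = begin
      gram ι S′ S′
        ≡⟨ Σ-inner-step k (λ a → Σ⟨ S′ ⟩ (ι a)) ⟩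
      expand (Σ⟨ S′ ⟩ (ι (+ suc k))) (gram ι S S′) (Σ⟨ S′ ⟩ (ι -[1+ k ]))
        ≡⟨ expand-cong top middle bottom ⟩
      expand (c * D + (P * F + (- c * (P - 1ℚ) + 0ℚ))) (c * F + (P * innerGramValue k + (- c * - F + 0ℚ)))
             (c * (P - 1ℚ) + (P * - F + (- c * D + 0ℚ)))
        ≡⟨ step P (P ^ℚ k) (ℕ→ℚ (suc k)) (geometric (suc k)) ⟩
      innerGramFormula (P ^ℚ (2 ℕ.+ k)) (ℕ→ℚ 2 + ℕ→ℚ (suc k)) (geometric (3 ℕ.+ k))
        ≡⟨ cong (λ N → innerGramFormula (P ^ℚ (2 ℕ.+ k)) N (geometric (3 ℕ.+ k))) (ℕ→ℚ-+ 2 (suc k)) ⟨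
      innerGramValue (suc (suc k)) ∎
    where
    open ≡-Reasoning
    S = inner (suc k)
    S′ = inner (3 ℕ.+ k)
    c = edgeCoeff k
    F = innerRowValue k
    D = - (P ^ℚ suc k + P ^ℚ suc k)
    expand : ℚ → ℚ → ℚ → ℚ
    expand x y z = c * x + (P * y + (- c * z + 0ℚ))
    expand-cong : ∀ {x x′ y y′ z z′} → x ≡ x′ → y ≡ y′ → z ≡ z′ → expand x y z ≡ expand x′ y′ z′
    expand-cong refl refl refl = refl
    top : Σ⟨ S′ ⟩ (ι (+ suc k)) ≡ c * D + (P * F + (- c * (P - 1ℚ) + 0ℚ))
    top = trans (Σ-inner-step k (ι (+ suc k)))
                (cong₂ (λ x y → c * x + (P * y + (- c * (P - 1ℚ) + 0ℚ))) (ιℕ-diag (suc k)) (Σ-inner-ι-above k (suc k) ℕP.≤-refl))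
    bottom : Σ⟨ S′ ⟩ (ι -[1+ k ]) ≡ c * (P - 1ℚ) + (P * - F + (- c * D + 0ℚ))
    bottom = trans (Σ-inner-step k (ι -[1+ k ]))
                   (cong₂ (λ x y → c * (P - 1ℚ) + (P * y + (- c * x + 0ℚ))) (ιℕ-diag (suc k)) (Σ-inner-ι-below k k ℕP.≤-refl))
    middle : gram ι S S′ ≡ c * F + (P * innerGramValue k + (- c * - F + 0ℚ))
    middle = begin
      gram ι S S′  ≡⟨ gram-sym ι-sym S S′ ⟩
      gram ι S′ S  ≡⟨ Σ-inner-step k (λ a → Σ⟨ S ⟩ (ι a)) ⟩
      c * Σ⟨ S ⟩ (ι (+ suc k)) + (P * gram ι S S + (- c * Σ⟨ S ⟩ (ι -[1+ k ]) + 0ℚ))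
        ≡⟨ expand-cong (Σ-inner-ι-above k (suc k) ℕP.≤-refl) (gram-inner k) (Σ-inner-ι-below k k ℕP.≤-refl) ⟩
      c * F + (P * innerGramValue k + (- c * - F + 0ℚ)) ∎
    step : ∀ P Q N G →
      let c = N * ½ * (P - 1ℚ)
          D = - (P * Q + P * Q)
          F = N * ½ * (P - 1ℚ) * (Q + 1ℚ) - P * Q + 1ℚ
          T = λ Q N G → ℕ→ℚ 2 * G - ℕ→ℚ 2 * N + N * (P - 1ℚ) * Q - N * N * ½ * (P - 1ℚ) * (Q + 1ℚ)
          expand = λ x y z → c * x + (P * y + (- c * z + 0ℚ))
      in expand (c * D + (P * F + (- c * (P - 1ℚ) + 0ℚ))) (c * F + (P * T Q N G + (- c * - F + 0ℚ)))
                (c * (P - 1ℚ) + (P * - F + (- c * D + 0ℚ)))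
         ≡ T (P * (P * Q)) (ℕ→ℚ 2 + N) (1ℚ + P * (1ℚ + P * G))
    step = solve-∀ ℚ-ring-for-solver

  ιₙ : ℕ → ℤ → ℤ → ℚ
  ιₙ n a b with ℤ.∣ a ∣ ℕ.≟ n | a ℤ.≟ b
  ... | yes _ | yes _ = - ((P - 1ℚ) * P ^ℚ (n ℕ.∸ 1))
  ... | _ | _ = ι a b

  ιₙ-outer : ∀ {n a} → ℤ.∣ a ∣ ≡ n → ιₙ n a a ≡ - ((P - 1ℚ) * P ^ℚ (n ℕ.∸ 1))
  ιₙ-outer {n} {a} ∣a∣≡n with ℤ.∣ a ∣ ℕ.≟ n | a ℤ.≟ a
  ... | yes _ | yes _ = refl
  ... | yes _ | no a≢a = ⊥-elim (a≢a refl)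
  ... | no ∣a∣≢n | _ = ⊥-elim (∣a∣≢n ∣a∣≡n)

  ιₙ-off : ∀ {n a b} → a ≢ b → ιₙ n a b ≡ ι a b
  ιₙ-off {n} {a} {b} a≢b with ℤ.∣ a ∣ ℕ.≟ n | a ℤ.≟ b
  ... | yes _ | yes a≡b = ⊥-elim (a≢b a≡b)
  ... | yes _ | no _ = refl
  ... | no _ | _ = refl

  ιₙ-inner : ∀ {n a} b → ℤ.∣ a ∣ ≢ n → ιₙ n a b ≡ ι a b
  ιₙ-inner {n} {a} b ∣a∣≢n with ℤ.∣ a ∣ ℕ.≟ n | a ℤ.≟ b
  ... | yes ∣a∣≡n | _ = ⊥-elim (∣a∣≢n ∣a∣≡n)
  ... | no _ | _ = refl

  selfValue : ℕ → ℚ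
  selfValue m = ℕ→ℚ 2 * geometric (suc m) - (P + 1ℚ) * ℕ→ℚ (suc m) * P ^ℚ m

  gram-cycle : ∀ m → gram (ιₙ (suc m)) (cycle (suc m)) (cycle (suc m)) ≡ selfValue m
  gram-cycle m = begin
      gram (ιₙ n) (O ++ S) C
        ≡⟨ Σ-++ O S (λ a → Σ⟨ C ⟩ (ιₙ n a)) ⟩
      combine (Σ⟨ C ⟩ (ιₙ n (+ n))) (Σ⟨ C ⟩ (ιₙ n -[1+ m ])) (Σ⟨ S ⟩ (λ a → Σ⟨ C ⟩ (ιₙ n a)))
        ≡⟨ combine-cong row-top row-bottom inner-rows ⟩
      total h
        ≡⟨ cong total (/2≡*½ (+ n)) ⟩
      total (ℕ→ℚ n * ½)
        ≡⟨ identity P (P ^ℚ m) (ℕ→ℚ n) (geometric n) ⟩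
      selfValue m ∎
    where
    open ≡-Reasoning
    n = suc m
    O = outer n
    S = inner n
    C = cycle n
    h = + n ℚ./ 2
    s = - ((P - 1ℚ) * P ^ℚ m)
    F = innerRowValue m
    total : ℚ → ℚ
    total h = h * (h * s + (- h * (P - 1ℚ) + 0ℚ) + F) + (- h * (h * (P - 1ℚ) + (- h * s + 0ℚ) + - F) + 0ℚ)
              + (h * F + (- h * - F + 0ℚ) + innerGramValue m)
    combine : ℚ → ℚ → ℚ → ℚ
    combine x y z = h * x + (- h * y + 0ℚ) + z
    combine-cong : ∀ {x x′ y y′ z z′} → x ≡ x′ → y ≡ y′ → z ≡ z′ → combine x y z ≡ combine x′ y′ z′
    combine-cong refl refl refl = refl
    ιₙ≗ι-on-S : ∀ {a} → ℤ.∣ a ∣ ≡ n → All (λ x → ιₙ n a (proj₁ x) ≡ ι a (proj₁ x)) S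
    ιₙ≗ι-on-S {a} ∣a∣≡n = All.map (λ {x} small → ιₙ-off {n} {a} {proj₁ x} (small⇒≢ small ∣a∣≡n)) (inner-small n)
    row-top : Σ⟨ C ⟩ (ιₙ n (+ n)) ≡ h * s + (- h * (P - 1ℚ) + 0ℚ) + F
    row-top = trans (Σ-++ O S (ιₙ n (+ n)))
      (cong₂ _+_ (cong₂ (λ x y → h * x + (- h * y + 0ℚ)) (ιₙ-outer {n} {+ n} refl) (ιₙ-off {n} {+ n} { -[1+ m ]} (λ ())))
                 (trans (Σ-congᴬ S (ιₙ≗ι-on-S {+ n} refl)) (Σ-inner-ι-above m n ℕP.≤-refl)))
    row-bottom : Σ⟨ C ⟩ (ιₙ n -[1+ m ]) ≡ h * (P - 1ℚ) + (- h * s + 0ℚ) + - F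
    row-bottom = trans (Σ-++ O S (ιₙ n -[1+ m ]))
      (cong₂ _+_ (cong₂ (λ x y → h * x + (- h * y + 0ℚ)) (ιₙ-off {n} { -[1+ m ]} {+ n} (λ ())) (ιₙ-outer {n} { -[1+ m ]} refl))
                 (trans (Σ-congᴬ S (ιₙ≗ι-on-S { -[1+ m ]} refl)) (Σ-inner-ι-below m m ℕP.≤-refl)))
    inner-rows : Σ⟨ S ⟩ (λ a → Σ⟨ C ⟩ (ιₙ n a)) ≡ h * F + (- h * - F + 0ℚ) + innerGramValue m
    inner-rows = begin
      Σ⟨ S ⟩ (λ a → Σ⟨ C ⟩ (ιₙ n a))
        ≡⟨ Σ-congᴬ S (All.map (λ {x} small → Σ-cong C (λ b → ιₙ-inner {n} {proj₁ x} b (+2≤⇒≢ small))) (inner-small n)) ⟩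
      gram ι S C                      ≡⟨ gram-sym ι-sym S C ⟩
      gram ι (O ++ S) S               ≡⟨ Σ-++ O S (λ a → Σ⟨ S ⟩ (ι a)) ⟩
      h * Σ⟨ S ⟩ (ι (+ n)) + (- h * Σ⟨ S ⟩ (ι -[1+ m ]) + 0ℚ) + gram ι S S
        ≡⟨ cong₂ (λ x y → h * x + (- h * y + 0ℚ) + gram ι S S) (Σ-inner-ι-above m n ℕP.≤-refl) (Σ-inner-ι-below m m ℕP.≤-refl) ⟩
      h * F + (- h * - F + 0ℚ) + gram ι S S
        ≡⟨ cong (λ x → h * F + (- h * - F + 0ℚ) + x) (gram-inner m) ⟩
      h * F + (- h * - F + 0ℚ) + innerGramValue m ∎
    identity : ∀ P Q N G →
      let h = N * ½
          s = - ((P - 1ℚ) * Q)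
          F = N * ½ * (P - 1ℚ) * (Q + 1ℚ) - P * Q + 1ℚ
          T = ℕ→ℚ 2 * G - ℕ→ℚ 2 * N + N * (P - 1ℚ) * Q - N * N * ½ * (P - 1ℚ) * (Q + 1ℚ)
      in h * (h * s + (- h * (P - 1ℚ) + 0ℚ) + F) + (- h * (h * (P - 1ℚ) + (- h * s + 0ℚ) + - F) + 0ℚ)
           + (h * F + (- h * - F + 0ℚ) + T)
         ≡ ℕ→ℚ 2 * G - (P + 1ℚ) * N * Q
    identity = solve-∀ ℚ-ring-for-solver

module SelfConstant where
  open import Data.Nat as ℕ using (_<_)
  import Data.Nat.Properties as ℕP
  open import Data.Nat.Primality using (prime⇒nonZero; prime⇒nonTrivial)
  open import Data.Rational as ℚ using (0ℚ; 1ℚ; _+_; _*_; -_; _-_)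
  import Data.Rational.Properties as ℚP
  open import Relation.Binary.PropositionalEquality
  open RationalArithmetic
  open DedekindPsi

  module _ {p : ℕ} (p-prime : Prime p) where

    1<p : 1 < p
    1<p = ℕ.nonTrivial⇒n>1 p {{prime⇒nonTrivial p-prime}}

    1≤p : 1 ≤ p
    1≤p = ℕP.<⇒≤ 1<p

    open InnerCombination p 1≤p
    open IntersectionNumbers p 1≤p

    P≢0 : P ≢ 0ℚ
    P≢0 = ℕ→ℚ-≢0 (ℕ.≢-nonZero⁻¹ p {{prime⇒nonZero p-prime}})

    P-1≢0 : P - 1ℚ ≢ 0ℚ
    P-1≢0 = subst (_≢ 0ℚ) (ℕ→ℚ-pred 1≤p) (ℕ→ℚ-≢0 (ℕP.m>n⇒m∸n≢0 1<p))

    P+1≢0 : P + 1ℚ ≢ 0ℚ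
    P+1≢0 = subst (_≢ 0ℚ) (trans (ℕ→ℚ-+ 1 p) (ℚP.+-comm 1ℚ P)) (ℕ→ℚ-≢0 {suc p} λ ())

    P^≢0 : ∀ k → P ^ℚ k ≢ 0ℚ
    P^≢0 k = subst (_≢ 0ℚ) (ℕ→ℚ-^ p k) (ℕ→ℚ-≢0 (ℕ.≢-nonZero⁻¹ (p ℕ.^ k) {{ℕP.m^n≢0 p k {{prime⇒nonZero p-prime}}}}))

    geometric-sum : ∀ k → (P - 1ℚ) * geometric k ≡ P ^ℚ k - 1ℚ
    geometric-sum zero = trans (ℚP.*-zeroʳ (P - 1ℚ)) (sym (ℚP.+-inverseʳ 1ℚ))
    geometric-sum (suc k) = begin
        (P - 1ℚ) * (1ℚ + P * geometric k)   ≡⟨ expand P (geometric k) ⟩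
        P - 1ℚ + P * ((P - 1ℚ) * geometric k) ≡⟨ cong (λ x → P - 1ℚ + P * x) (geometric-sum k) ⟩
        P - 1ℚ + P * (P ^ℚ k - 1ℚ)           ≡⟨ collect P (P ^ℚ k) ⟩
        P * P ^ℚ k - 1ℚ                      ∎
      where
      open ≡-Reasoning
      expand : ∀ P G → (P - 1ℚ) * (1ℚ + P * G) ≡ P - 1ℚ + P * ((P - 1ℚ) * G)
      expand = solve-∀ ℚ-ring-for-solver
      collect : ∀ P Q → P - 1ℚ + P * (Q - 1ℚ) ≡ P * Q - 1ℚ
      collect = solve-∀ ℚ-ring-for-solver

    P^[1+m]⊘P : ∀ m → P ^ℚ suc m ⊘ P ≡ P ^ℚ m
    P^[1+m]⊘P m = trans (cong (_⊘ P) (ℚP.*-comm P (P ^ℚ m))) (*-⊘-cancel (P ^ℚ m) P≢0)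

    denominator≡ : ∀ m → (P ^ℚ suc m ⊘ P) * (P ^ℚ 2 - 1ℚ) ≡ P ^ℚ m * ((P - 1ℚ) * (P + 1ℚ))
    denominator≡ m = trans (cong (_* (P ^ℚ 2 - 1ℚ)) (P^[1+m]⊘P m)) (difference-of-squares (P ^ℚ m) P)
      where
      difference-of-squares : ∀ Q P → Q * (P * (P * 1ℚ) - 1ℚ) ≡ Q * ((P - 1ℚ) * (P + 1ℚ))
      difference-of-squares = solve-∀ ℚ-ring-for-solver

    numerator≡ : ∀ m → let N = ℕ→ℚ (suc m) in
      - (N * P ^ℚ (suc m ℕ.+ 1)) + ℕ→ℚ 2 * P ^ℚ suc m + N * (P ^ℚ suc m ⊘ P) - ℕ→ℚ 2 ≡ (P - 1ℚ) * selfValue m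
    numerator≡ m = begin
        - (N * P ^ℚ (suc m ℕ.+ 1)) + ℕ→ℚ 2 * P ^ℚ suc m + N * (P ^ℚ suc m ⊘ P) - ℕ→ℚ 2
          ≡⟨ cong₂ (λ e x → - (N * P ^ℚ e) + ℕ→ℚ 2 * P ^ℚ suc m + N * x - ℕ→ℚ 2) (ℕP.+-comm (suc m) 1) (P^[1+m]⊘P m) ⟩
        - (N * (P * (P * Q))) + ℕ→ℚ 2 * (P * Q) + N * Q - ℕ→ℚ 2
          ≡⟨ rearrange P Q N ⟩
        ℕ→ℚ 2 * (P * Q - 1ℚ) - (P - 1ℚ) * (P + 1ℚ) * N * Q
          ≡⟨ cong (λ x → ℕ→ℚ 2 * x - (P - 1ℚ) * (P + 1ℚ) * N * Q) (geometric-sum (suc m)) ⟨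
        ℕ→ℚ 2 * ((P - 1ℚ) * geometric (suc m)) - (P - 1ℚ) * (P + 1ℚ) * N * Q
          ≡⟨ factor P Q N (geometric (suc m)) ⟩
        (P - 1ℚ) * selfValue m ∎
      where
      open ≡-Reasoning
      Q = P ^ℚ m
      N = ℕ→ℚ (suc m)
      rearrange : ∀ P Q N → - (N * (P * (P * Q))) + ℕ→ℚ 2 * (P * Q) + N * Q - ℕ→ℚ 2
                            ≡ ℕ→ℚ 2 * (P * Q - 1ℚ) - (P - 1ℚ) * (P + 1ℚ) * N * Q
      rearrange = solve-∀ ℚ-ring-for-solver
      factor : ∀ P Q N G → ℕ→ℚ 2 * ((P - 1ℚ) * G) - (P - 1ℚ) * (P + 1ℚ) * N * Q
                           ≡ (P - 1ℚ) * (ℕ→ℚ 2 * G - (P + 1ℚ) * N * Q)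
      factor = solve-∀ ℚ-ring-for-solver

    module _ (m Nₚ : ℕ) (p∤Nₚ : ¬ p ∣ Nₚ) where

      ψ⊘24 : ψ (p ℕ.^ suc m ℕ.* Nₚ) ⊘ ℕ→ℚ 24 ≡ κ Nₚ * (P ^ℚ m * (P + 1ℚ))
      ψ⊘24 = begin
          ψ (p ℕ.^ suc m ℕ.* Nₚ) ⊘ ℕ→ℚ 24
            ≡⟨ ⊘-≡-*-1⊘ (ψ (p ℕ.^ suc m ℕ.* Nₚ)) (ℕ→ℚ 24) ⟩
          ψ (p ℕ.^ suc m ℕ.* Nₚ) * (1ℚ ⊘ ℕ→ℚ 24)
            ≡⟨ cong (_* (1ℚ ⊘ ℕ→ℚ 24))
                    (trans (ψ-p^[1+k]*N p-prime m Nₚ p∤Nₚ) (cong (λ x → x * eulerFactor p * ψ Nₚ) (ℕ→ℚ-^ p (suc m)))) ⟩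
          P * P ^ℚ m * (1ℚ + (1ℚ ⊘ P)) * ψ Nₚ * (1ℚ ⊘ ℕ→ℚ 24)
            ≡⟨ regroup P (P ^ℚ m) (1ℚ ⊘ P) (ψ Nₚ) (1ℚ ⊘ ℕ→ℚ 24) ⟩
          κ Nₚ * (P ^ℚ m * (P + P * (1ℚ ⊘ P)))
            ≡⟨ cong (λ x → κ Nₚ * (P ^ℚ m * (P + x))) P*1⊘P ⟩
          κ Nₚ * (P ^ℚ m * (P + 1ℚ)) ∎
        where
        open ≡-Reasoning
        regroup : ∀ P Q r ψ i → P * Q * (1ℚ + r) * ψ * i ≡ ψ * i * (Q * (P + P * r))
        regroup = solve-∀ ℚ-ring-for-solver
        P*1⊘P : P * (1ℚ ⊘ P) ≡ 1ℚ
        P*1⊘P = trans (trans (cong (_* (1ℚ ⊘ P)) (sym (ℚP.*-identityˡ P))) (sym (⊘-≡-*-1⊘ (1ℚ * P) P))) (*-⊘-cancel 1ℚ P≢0)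

      selfConst≡ : selfConst p (suc m) (p ℕ.^ suc m ℕ.* Nₚ) ≡ κ Nₚ * selfValue m
      selfConst≡ = begin
          selfConst p (suc m) (p ℕ.^ suc m ℕ.* Nₚ)
            ≡⟨ cong₂ (λ x y → x * (y ⊘ ((P ^ℚ suc m ⊘ P) * (P ^ℚ 2 - 1ℚ)))) ψ⊘24 (numerator≡ m) ⟩
          κ Nₚ * (Q * (P + 1ℚ)) * (((P - 1ℚ) * selfValue m) ⊘ ((P ^ℚ suc m ⊘ P) * (P ^ℚ 2 - 1ℚ)))
            ≡⟨ cong (λ d → κ Nₚ * (Q * (P + 1ℚ)) * (((P - 1ℚ) * selfValue m) ⊘ d)) (denominator≡ m) ⟩
          κ Nₚ * (Q * (P + 1ℚ)) * (((P - 1ℚ) * selfValue m) ⊘ d)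
            ≡⟨ *-⊘-assoc (κ Nₚ * (Q * (P + 1ℚ))) ((P - 1ℚ) * selfValue m) d ⟩
          (κ Nₚ * (Q * (P + 1ℚ)) * ((P - 1ℚ) * selfValue m)) ⊘ d
            ≡⟨ cong (_⊘ d) (regroup (κ Nₚ) Q P (selfValue m)) ⟩
          (κ Nₚ * selfValue m * d) ⊘ d
            ≡⟨ *-⊘-cancel _ (*-≢0 (P^≢0 m) (*-≢0 P-1≢0 P+1≢0)) ⟩
          κ Nₚ * selfValue m ∎
        where
        open ≡-Reasoning
        Q = P ^ℚ m
        d = Q * ((P - 1ℚ) * (P + 1ℚ))
        regroup : ∀ k Q P σ → k * (Q * (P + 1ℚ)) * ((P - 1ℚ) * σ) ≡ k * σ * (Q * ((P - 1ℚ) * (P + 1ℚ)))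
        regroup = solve-∀ ℚ-ring-for-solver

  selfConst-0 : ∀ p N → selfConst p 0 N ≡ 0ℚ
  selfConst-0 p N = begin
      (ψ N ⊘ ℕ→ℚ 24) * (numerator ⊘ den) ≡⟨ cong (λ x → (ψ N ⊘ ℕ→ℚ 24) * (x ⊘ den)) (vanishes (ℕ→ℚ p ^ℚ 1) pⁿ⁻¹) ⟩
      (ψ N ⊘ ℕ→ℚ 24) * (0ℚ ⊘ den)       ≡⟨ cong ((ψ N ⊘ ℕ→ℚ 24) *_) (trans (⊘-≡-*-1⊘ 0ℚ den) (ℚP.*-zeroˡ (1ℚ ⊘ den))) ⟩
      (ψ N ⊘ ℕ→ℚ 24) * 0ℚ               ≡⟨ ℚP.*-zeroʳ (ψ N ⊘ ℕ→ℚ 24) ⟩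
      0ℚ                                ∎
    where
    open ≡-Reasoning
    pⁿ⁻¹ = (ℕ→ℚ p ^ℚ 0) ⊘ ℕ→ℚ p
    den = pⁿ⁻¹ * (ℕ→ℚ p ^ℚ 2 - 1ℚ)
    numerator = - (ℕ→ℚ 0 * (ℕ→ℚ p ^ℚ (0 ℕ.+ 1))) + ℕ→ℚ 2 * (ℕ→ℚ p ^ℚ 0) + ℕ→ℚ 0 * pⁿ⁻¹ - ℕ→ℚ 2
    vanishes : ∀ x y → - (ℕ→ℚ 0 * x) + ℕ→ℚ 2 * 1ℚ + ℕ→ℚ 0 * y - ℕ→ℚ 2 ≡ 0ℚ
    vanishes = solve-∀ ℚ-ring-for-solver

module CycleEvaluation (M : Module ℚ-ring 0ℓ 0ℓ) where
  import Data.Nat as ℕ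
  open import Data.Integer as ℤ using (+_; -[1+_])
  import Data.Integer.Properties as ℤP
  open import Data.Rational as ℚ using (ℚ; 0ℚ; _+_; -_)
  import Data.Rational.Properties as ℚP
  open import Data.List using ([]; _∷_; _++_; map; [_])
  open import Data.List.Relation.Unary.All as All using ([]; _∷_)
  open import Function using (_∘_)
  import Algebra.Module.Properties as ModuleProperties
  open import Relation.Binary.PropositionalEquality as ≡ using (_≡_; refl; cong)
  import Relation.Binary.Reasoning.Setoid as SetoidReasoning
  open RationalArithmetic
  open Combinations
  open Module M
  open Evaluation M
  open SetoidReasoning ≈ᴹ-setoid

  Even : (ℤ → Carrierᴹ) → Set
  Even Y = ∀ a → Y (ℤ.- a) ≈ᴹ Y a

  cancel-pair : ∀ c {v w} → v ≈ᴹ w → c *ₗ v +ᴹ ((- c) *ₗ w +ᴹ 0ᴹ) ≈ᴹ 0ᴹ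
  cancel-pair c {v} {w} v≈w = begin
      c *ₗ v +ᴹ ((- c) *ₗ w +ᴹ 0ᴹ)  ≈⟨ +ᴹ-cong (*ₗ-congˡ v≈w) (+ᴹ-identityʳ _) ⟩
      c *ₗ w +ᴹ (- c) *ₗ w          ≈⟨ *ₗ-distribʳ w c (- c) ⟨
      (c + - c) *ₗ w               ≈⟨ *ₗ-congʳ (ℚP.+-inverseʳ c) ⟩
      0ℚ *ₗ w                      ≈⟨ *ₗ-zeroˡ w ⟩
      0ᴹ                           ∎

  module _ (p : ℕ) (1≤p : 1 ≤ p) {Y : ℤ → Carrierᴹ} (Y-even : Even Y) where
    open InnerCombination p 1≤p

    eval-even-inner : ∀ n → eval Y (inner n) ≈ᴹ 0ᴹ
    eval-even-inner zero = ≈ᴹ-refl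
    eval-even-inner (suc zero) = ≈ᴹ-refl
    eval-even-inner (suc (suc zero)) = begin
        eval Y (inner 2)         ≡⟨ cong (eval Y) inner-2 ⟩
        0ℚ *ₗ Y (+ 0) +ᴹ 0ᴹ      ≈⟨ +ᴹ-identityʳ _ ⟩
        0ℚ *ₗ Y (+ 0)            ≈⟨ *ₗ-zeroˡ _ ⟩
        0ᴹ                       ∎
    eval-even-inner (suc (suc (suc k))) = begin
        eval Y (inner (3 ℕ.+ k))
          ≡⟨ cong (eval Y) (inner-step k) ⟩
        c *ₗ Y (+ suc k) +ᴹ eval Y (scale P (inner (suc k)) ++ [ (-[1+ k ] , - c) ])
          ≈⟨ +ᴹ-congˡ (eval-++ Y (scale P (inner (suc k))) _) ⟩
        c *ₗ Y (+ suc k) +ᴹ (eval Y (scale P (inner (suc k))) +ᴹ ((- c) *ₗ Y -[1+ k ] +ᴹ 0ᴹ))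
          ≈⟨ +ᴹ-congˡ (+ᴹ-congʳ (≈ᴹ-trans (eval-scale Y P (inner (suc k))) (≈ᴹ-trans (*ₗ-congˡ (eval-even-inner (suc k))) (*ₗ-zeroʳ P)))) ⟩
        c *ₗ Y (+ suc k) +ᴹ (0ᴹ +ᴹ ((- c) *ₗ Y -[1+ k ] +ᴹ 0ᴹ))
          ≈⟨ +ᴹ-congˡ (+ᴹ-identityˡ _) ⟩
        c *ₗ Y (+ suc k) +ᴹ ((- c) *ₗ Y -[1+ k ] +ᴹ 0ᴹ)
          ≈⟨ cancel-pair c (≈ᴹ-sym (Y-even (+ suc k))) ⟩
        0ᴹ ∎
      where c = edgeCoeff k

    eval-even-cycle : ∀ n → eval Y (cycle n) ≈ᴹ 0ᴹ
    eval-even-cycle n = begin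
        eval Y (outer n ++ inner n)
          ≈⟨ eval-++ Y (outer n) (inner n) ⟩
        eval Y (outer n) +ᴹ eval Y (inner n)
          ≈⟨ +ᴹ-cong (cancel-pair (+ n ℚ./ 2) (≈ᴹ-sym (Y-even (+ n)))) (eval-even-inner n) ⟩
        0ᴹ +ᴹ 0ᴹ
          ≈⟨ +ᴹ-identityˡ 0ᴹ ⟩
        0ᴹ ∎

  module _ (p : ℕ) (1≤p : 1 ≤ p) (X : ℤ → Carrierᴹ) where
    open InnerCombination p 1≤p

    eval-neg-cycle : ∀ n → eval (X ∘ ℤ.-_) (cycle n) ≈ᴹ -ᴹ eval X (cycle n)
    eval-neg-cycle n = inverseʳ-uniqueᴹ (eval X (cycle n)) _ (begin
        eval X (cycle n) +ᴹ eval (X ∘ ℤ.-_) (cycle n) ≈⟨ eval-+ᴹ X (X ∘ ℤ.-_) (cycle n) ⟨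
        eval (λ a → X a +ᴹ X (ℤ.- a)) (cycle n)          ≈⟨ eval-even-cycle p 1≤p even n ⟩
        0ᴹ ∎)
      where
      open ModuleProperties M using (inverseʳ-uniqueᴹ)
      even : Even (λ a → X a +ᴹ X (ℤ.- a))
      even a = ≈ᴹ-trans (+ᴹ-comm _ _) (+ᴹ-congʳ (≈ᴹ-reflexive (cong X (ℤP.neg-involutive a))))

    sumᴹ-map≡eval : ∀ (w : ℤ → ℚ) is → sumᴹ M (map (λ a → w a *ₗ X a) is) ≡ eval X (map (λ a → a , w a) is)
    sumᴹ-map≡eval w [] = refl
    sumᴹ-map≡eval w (a ∷ is) = cong (w a *ₗ X a +ᴹ_) (sumᴹ-map≡eval w is)

    Xhat≈eval-cycle : ∀ n → Xhat M p n X ≈ᴹ eval X (cycle n)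
    Xhat≈eval-cycle n = begin
        (h *ₗ X (+ n) +ᴹ (- h) *ₗ X (ℤ.- + n)) +ᴹ sumᴹ M (map (λ a → coeff n a *ₗ X a) (innerIndices ℚ-module n))
          ≈⟨ +ᴹ-cong (+ᴹ-congˡ (≈ᴹ-sym (+ᴹ-identityʳ _))) (≈ᴹ-reflexive (sumᴹ-map≡eval (coeff n) (innerIndices ℚ-module n))) ⟩
        eval X (outer n) +ᴹ eval X (inner n)
          ≈⟨ eval-++ X (outer n) (inner n) ⟨
        eval X (cycle n) ∎
      where h = + n ℚ./ 2

module UnderHypotheses {p n Nₚ : ℕ} {V R : Module ℚ-ring 0ℓ 0ℓ} {L : Module.Carrierᴹ R}
    {X : ℤ → Module.Carrierᴹ V} {W : Module.Carrierᴹ V → Module.Carrierᴹ V}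
    {pair : Module.Carrierᴹ V → Module.Carrierᴹ V → Module.Carrierᴹ R}
    (H : Hyp p n Nₚ V R L X W pair) where
  open import Data.Nat as ℕ using (z≤n)
  open import Data.Integer as ℤ using (+_; -[1+_])
  import Data.Integer.Properties as ℤP
  open import Data.Rational as ℚ using (ℚ; 0ℚ; 1ℚ; _+_; _*_; -_; _-_)
  import Data.Rational.Properties as ℚP
  open import Data.List.Relation.Unary.All as All using (All)
  open import Data.Product using (proj₁)
  open import Function using (_∘_)
  open import Relation.Nullary using (yes; no)
  open import Relation.Binary.PropositionalEquality as ≡ using (_≡_; _≢_; refl; cong; cong₂; trans; module ≡-Reasoning)
  import Relation.Binary.Reasoning.Setoid as SetoidReasoning
  open RationalArithmetic
  open Combinations
  open DedekindPsi
  open SelfConstant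
  open CycleEvaluation
  open Hyp H
  private
    module V = Module V
    module R = Module R
  open Evaluation

  Valid⟨_⟩ : Combination → Set
  Valid⟨ xs ⟩ = All (Valid n ∘ proj₁) xs

  W-eval : ∀ xs → Valid⟨ xs ⟩ → W (eval V X xs) V.≈ᴹ eval V (X ∘ ℤ.-_) xs
  W-eval xs valid = V.≈ᴹ-trans (eval-linear V V W W-cong W-+ W-* X xs) (eval-cong V xs (All.map (W-X _) valid))

  eval-*ₗL : ∀ (k : ℚ) f xs → eval R (λ a → (k * f a) R.*ₗ L) xs R.≈ᴹ (k * Σ⟨ xs ⟩ f) R.*ₗ L
  eval-*ₗL k f xs = R.≈ᴹ-trans
    (R.≈ᴹ-sym (eval-linear ℚ-module R (R._*ₗ L) R.*ₗ-congʳ (λ x y → R.*ₗ-distribʳ L x y) (λ c x → R.*ₗ-assoc c x L) (λ a → k * f a) xs))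
    (R.*ₗ-congʳ (Σ-* k xs f))

  pair-eval : ∀ k g → (∀ a b → Valid n a → Valid n b → pair (X a) (X b) R.≈ᴹ (k * g a b) R.*ₗ L) →
    ∀ xs ys → Valid⟨ xs ⟩ → Valid⟨ ys ⟩ → pair (eval V X xs) (eval V X ys) R.≈ᴹ (k * gram g xs ys) R.*ₗ L
  pair-eval k g link xs ys valid-xs valid-ys = begin
      pair (eval V X xs) (eval V X ys)
        ≈⟨ eval-linear V R (λ v → pair v (eval V X ys)) (λ v≈v′ → pair-cong v≈v′ V.≈ᴹ-refl)
                       (λ v v′ → pair-+ˡ v v′ _) (λ q v → pair-*ˡ q v _) X xs ⟩
      eval R (λ a → pair (X a) (eval V X ys)) xs
        ≈⟨ eval-cong R xs (All.map (λ {x} → row {proj₁ x}) valid-xs) ⟩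
      eval R (λ a → (k * Σ⟨ ys ⟩ (g a)) R.*ₗ L) xs
        ≈⟨ eval-*ₗL k (λ a → Σ⟨ ys ⟩ (g a)) xs ⟩
      (k * gram g xs ys) R.*ₗ L ∎
    where
    open SetoidReasoning R.≈ᴹ-setoid
    row : ∀ {a} → Valid n a → pair (X a) (eval V X ys) R.≈ᴹ (k * Σ⟨ ys ⟩ (g a)) R.*ₗ L
    row {a} valid-a = begin
      pair (X a) (eval V X ys)
        ≈⟨ eval-linear V R (pair (X a)) (pair-cong V.≈ᴹ-refl) (pair-+ʳ (X a)) (λ q v → pair-*ʳ q (X a) v) X ys ⟩
      eval R (λ b → pair (X a) (X b)) ys
        ≈⟨ eval-cong R ys (All.map (link a _ valid-a) valid-ys) ⟩
      eval R (λ b → (k * g a b) R.*ₗ L) ys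
        ≈⟨ eval-*ₗL k (g a) ys ⟩
      (k * Σ⟨ ys ⟩ (g a)) R.*ₗ L ∎

  pair-0ᴹ : ∀ v → pair v V.0ᴹ R.≈ᴹ R.0ᴹ
  pair-0ᴹ v = R.≈ᴹ-trans (pair-cong V.≈ᴹ-refl (V.≈ᴹ-sym (V.*ₗ-zeroˡ V.0ᴹ))) (R.≈ᴹ-trans (pair-*ʳ 0ℚ v V.0ᴹ) (R.*ₗ-zeroˡ _))

  pair-Xhat-0 : ∀ N → pair (Xhat V p 0 X) (Xhat V p 0 X) R.≈ᴹ selfConst p 0 N R.*ₗ L
  pair-Xhat-0 N = begin
      pair (Xhat V p 0 X) (Xhat V p 0 X)  ≈⟨ pair-cong Xhat₀≈0 Xhat₀≈0 ⟩
      pair V.0ᴹ V.0ᴹ                      ≈⟨ pair-0ᴹ V.0ᴹ ⟩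
      R.0ᴹ                                ≈⟨ R.*ₗ-zeroˡ L ⟨
      0ℚ R.*ₗ L                           ≈⟨ R.*ₗ-congʳ (selfConst-0 p N) ⟨
      selfConst p 0 N R.*ₗ L              ∎
    where
    open SetoidReasoning R.≈ᴹ-setoid
    Xhat₀≈0 : Xhat V p 0 X V.≈ᴹ V.0ᴹ
    Xhat₀≈0 = V.≈ᴹ-trans (V.+ᴹ-identityʳ _) (V.≈ᴹ-trans (V.+ᴹ-cong (V.*ₗ-zeroˡ _) (V.*ₗ-zeroˡ _)) (V.+ᴹ-identityʳ V.0ᴹ))

  module _ (1≤p : 1 ≤ p) where
    open InnerCombination p 1≤p
    open IntersectionNumbers p 1≤p

    W-Xhat : W (Xhat V p n X) V.≈ᴹ V.-ᴹ Xhat V p n X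
    W-Xhat = begin
        W (Xhat V p n X)               ≈⟨ W-cong (Xhat≈eval-cycle V p 1≤p X n) ⟩
        W (eval V X (cycle n))         ≈⟨ W-eval (cycle n) (cycle-valid n) ⟩
        eval V (X ∘ ℤ.-_) (cycle n)    ≈⟨ eval-neg-cycle V p 1≤p X n ⟩
        V.-ᴹ eval V X (cycle n)        ≈⟨ V.-ᴹ‿cong (Xhat≈eval-cycle V p 1≤p X n) ⟨
        V.-ᴹ Xhat V p n X              ∎
      where open SetoidReasoning V.≈ᴹ-setoid

    private
      c≡κ*[P-1] : ψ Nₚ * ℕ→ℚ (p ℕ.∸ 1) * (1ℚ ⊘ ℕ→ℚ 24) ≡ κ Nₚ * (P - 1ℚ)
      c≡κ*[P-1] = trans (cong (λ x → ψ Nₚ * x * (1ℚ ⊘ ℕ→ℚ 24)) (ℕ→ℚ-pred 1≤p)) (swap (ψ Nₚ) (P - 1ℚ) (1ℚ ⊘ ℕ→ℚ 24))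
        where
        swap : ∀ a b c → a * b * c ≡ a * c * b
        swap = solve-∀ ℚ-ring-for-solver

      off-scalar : ∀ {x y} → x ≢ y → ψ Nₚ * ℕ→ℚ (p ℕ.∸ 1) * (1ℚ ⊘ ℕ→ℚ 24) * ℕ→ℚ (p ℕ.^ (x ℕ.⊓ y)) ≡ κ Nₚ * ιℕ x y
      off-scalar {x} {y} x≢y = begin
          ψ Nₚ * ℕ→ℚ (p ℕ.∸ 1) * (1ℚ ⊘ ℕ→ℚ 24) * ℕ→ℚ (p ℕ.^ (x ℕ.⊓ y))
            ≡⟨ cong₂ _*_ c≡κ*[P-1] (ℕ→ℚ-^ p (x ℕ.⊓ y)) ⟩
          κ Nₚ * (P - 1ℚ) * P ^ℚ (x ℕ.⊓ y)
            ≡⟨ ℚP.*-assoc (κ Nₚ) _ _ ⟩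
          κ Nₚ * ((P - 1ℚ) * P ^ℚ (x ℕ.⊓ y))
            ≡⟨ cong (κ Nₚ *_) (ιℕ-off x≢y) ⟨
          κ Nₚ * ιℕ x y ∎
        where open ≡-Reasoning

      self-scalar : ∀ x → - (ψ Nₚ * ℕ→ℚ (p ℕ.^ x) * (1ℚ ⊘ ℕ→ℚ 12)) ≡ κ Nₚ * ιℕ x x
      self-scalar x = begin
          - (ψ Nₚ * ℕ→ℚ (p ℕ.^ x) * (1ℚ ⊘ ℕ→ℚ 12)) ≡⟨ cong (λ y → - (ψ Nₚ * y * (1ℚ ⊘ ℕ→ℚ 12))) (ℕ→ℚ-^ p x) ⟩
          - (ψ Nₚ * P ^ℚ x * (1ℚ ⊘ ℕ→ℚ 12))        ≡⟨ halve (ψ Nₚ) (P ^ℚ x) ⟩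
          κ Nₚ * - (P ^ℚ x + P ^ℚ x)               ≡⟨ cong (κ Nₚ *_) (ιℕ-diag x) ⟨
          κ Nₚ * ιℕ x x                            ∎
        where
        open ≡-Reasoning
        halve : ∀ a b → - (a * b * (1ℚ ⊘ ℕ→ℚ 12)) ≡ a * (1ℚ ⊘ ℕ→ℚ 24) * - (b + b)
        halve = solve-∀ ℚ-ring-for-solver

      outer-scalar : - (ψ Nₚ * ℕ→ℚ (p ℕ.∸ 1) * ℕ→ℚ (p ℕ.^ (n ℕ.∸ 1)) * (1ℚ ⊘ ℕ→ℚ 24))
                     ≡ κ Nₚ * - ((P - 1ℚ) * P ^ℚ (n ℕ.∸ 1))
      outer-scalar = begin
          - (ψ Nₚ * ℕ→ℚ (p ℕ.∸ 1) * ℕ→ℚ (p ℕ.^ (n ℕ.∸ 1)) * (1ℚ ⊘ ℕ→ℚ 24))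
            ≡⟨ cong₂ (λ y z → - (ψ Nₚ * y * z * (1ℚ ⊘ ℕ→ℚ 24))) (ℕ→ℚ-pred 1≤p) (ℕ→ℚ-^ p (n ℕ.∸ 1)) ⟩
          - (ψ Nₚ * (P - 1ℚ) * P ^ℚ (n ℕ.∸ 1) * (1ℚ ⊘ ℕ→ℚ 24))
            ≡⟨ regroup (ψ Nₚ) (P - 1ℚ) (P ^ℚ (n ℕ.∸ 1)) (1ℚ ⊘ ℕ→ℚ 24) ⟩
          κ Nₚ * - ((P - 1ℚ) * P ^ℚ (n ℕ.∸ 1)) ∎
        where
        open ≡-Reasoning
        regroup : ∀ a b c d → - (a * b * c * d) ≡ a * d * - (b * c)
        regroup = solve-∀ ℚ-ring-for-solver

      +*+≥0 : ∀ x y → ℤ.0ℤ ℤ.≤ + x ℤ.* + y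
      +*+≥0 x y = ≡.subst (ℤ.0ℤ ℤ.≤_) (ℤP.pos-* x y) (ℤ.+≤+ z≤n)

      +*-≤0 : ∀ x y → + x ℤ.* -[1+ y ] ℤ.≤ ℤ.0ℤ
      +*-≤0 zero y = ℤ.+≤+ z≤n
      +*-≤0 (suc x) y = ℤ.-≤+

      link-off : ∀ a b → Valid n a → Valid n b → a ≢ b → pair (X a) (X b) R.≈ᴹ (κ Nₚ * ι a b) R.*ₗ L
      link-off (+ x) (+ y) va vb a≢b =
        R.≈ᴹ-trans (pair-same-sign _ _ va vb a≢b (+*+≥0 x y)) (R.*ₗ-congʳ (off-scalar (a≢b ∘ cong (λ z → + z))))
      link-off (+ x) -[1+ y ] va vb a≢b =
        R.≈ᴹ-trans (pair-opp-sign _ _ va vb a≢b (+*-≤0 x y)) (R.*ₗ-congʳ c≡κ*[P-1])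
      link-off -[1+ x ] (+ y) va vb a≢b =
        R.≈ᴹ-trans (pair-opp-sign _ _ va vb a≢b (≡.subst (ℤ._≤ ℤ.0ℤ) (ℤP.*-comm (+ y) -[1+ x ]) (+*-≤0 y x))) (R.*ₗ-congʳ c≡κ*[P-1])
      link-off -[1+ x ] -[1+ y ] va vb a≢b =
        R.≈ᴹ-trans (pair-same-sign _ _ va vb a≢b (ℤ.+≤+ z≤n)) (R.*ₗ-congʳ (off-scalar (a≢b ∘ cong (λ z → ℤ.- (+ z)))))

    link : 1 ≤ n → ∀ a b → Valid n a → Valid n b → pair (X a) (X b) R.≈ᴹ (κ Nₚ * ιₙ n a b) R.*ₗ L
    link 1≤n a b va vb with ℤ.∣ a ∣ ℕ.≟ n | a ℤ.≟ b
    ... | yes ∣a∣≡n | yes refl = R.≈ᴹ-trans (pair-self-outer a va ∣a∣≡n 1≤n) (R.*ₗ-congʳ outer-scalar)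
    ... | no ∣a∣≢n | yes refl = R.≈ᴹ-trans (pair-self-inner a va ∣a∣≢n) (R.*ₗ-congʳ (inner-scalar a))
      where
      inner-scalar : ∀ a → - (ψ Nₚ * ℕ→ℚ (p ℕ.^ ℤ.∣ a ∣) * (1ℚ ⊘ ℕ→ℚ 12)) ≡ κ Nₚ * ι a a
      inner-scalar (+ x) = self-scalar x
      inner-scalar -[1+ x ] = self-scalar (suc x)
    ... | yes _ | no a≢b = link-off a b va vb a≢b
    ... | no _ | no a≢b = link-off a b va vb a≢b

module SelfIntersection {p m Nₚ : ℕ} (p-prime : Prime p) (p∤Nₚ : ¬ p ∣ Nₚ)
    {V R : Module ℚ-ring 0ℓ 0ℓ} {L : Module.Carrierᴹ R}
    {X : ℤ → Module.Carrierᴹ V} {W : Module.Carrierᴹ V → Module.Carrierᴹ V}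
    {pair : Module.Carrierᴹ V → Module.Carrierᴹ V → Module.Carrierᴹ R}
    (H : Hyp p (suc m) Nₚ V R L X W pair) where
  open import Data.Nat as ℕ using (s≤s; z≤n)
  import Data.Rational as ℚ
  open import Relation.Binary.PropositionalEquality using (cong)
  import Relation.Binary.Reasoning.Setoid as SetoidReasoning
  open Combinations
  open CycleEvaluation
  open Hyp H
  open UnderHypotheses H
  open DedekindPsi
  open SelfConstant using (1≤p; selfConst≡)
  private
    module R = Module R
    n = suc m
  open InnerCombination p (1≤p p-prime)
  open IntersectionNumbers p (1≤p p-prime)
  open SetoidReasoning R.≈ᴹ-setoid

  pair-Xhat : pair (Xhat V p n X) (Xhat V p n X) R.≈ᴹ selfConst p n (p ℕ.^ n ℕ.* Nₚ) R.*ₗ L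
  pair-Xhat = begin
      pair (Xhat V p n X) (Xhat V p n X)
        ≈⟨ pair-cong Xhat≈C Xhat≈C ⟩
      pair (Evaluation.eval V X (cycle n)) (Evaluation.eval V X (cycle n))
        ≈⟨ pair-eval (κ Nₚ) (ιₙ n) (link (1≤p p-prime) (s≤s z≤n)) (cycle n) (cycle n) (cycle-valid n) (cycle-valid n) ⟩
      (κ Nₚ ℚ.* gram (ιₙ n) (cycle n) (cycle n)) R.*ₗ L
        ≈⟨ R.*ₗ-congʳ (cong (κ Nₚ ℚ.*_) (gram-cycle m)) ⟩
      (κ Nₚ ℚ.* selfValue m) R.*ₗ L
        ≈⟨ R.*ₗ-congʳ (selfConst≡ p-prime m Nₚ p∤Nₚ) ⟨
      selfConst p n (p ℕ.^ n ℕ.* Nₚ) R.*ₗ L ∎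
    where Xhat≈C = Xhat≈eval-cycle V p (1≤p p-prime) X n

open import Data.Nat using (_^_; _*_)
open SelfConstant using (1≤p)

corollary6p3p2 : (p n Np : ℕ) → Prime p → ¬ (p ∣ Np) →
    (V R : Module ℚ-ring 0ℓ 0ℓ) (L : Module.Carrierᴹ R)
    (X : ℤ → Module.Carrierᴹ V) (W : Module.Carrierᴹ V → Module.Carrierᴹ V)
    (pair : Module.Carrierᴹ V → Module.Carrierᴹ V → Module.Carrierᴹ R) →
    Hyp p n Np V R L X W pair →
    Module._≈ᴹ_ V (W (Xhat V p n X)) (Module.-ᴹ_ V (Xhat V p n X))
    × Module._≈ᴹ_ R (pair (Xhat V p n X) (Xhat V p n X))
        (Module._*ₗ_ R (selfConst p n (p ^ n * Np)) L)
corollary6p3p2 p zero Np p-prime p∤Np V R L X W pair H =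
  UnderHypotheses.W-Xhat H (1≤p p-prime) , UnderHypotheses.pair-Xhat-0 H (p ^ 0 * Np)
corollary6p3p2 p (suc m) Np p-prime p∤Np V R L X W pair H =
  UnderHypotheses.W-Xhat H (1≤p p-prime) , SelfIntersection.pair-Xhat p-prime p∤Np H
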